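{- Let $p=(2143,R)$ where $R\subseteq([3]\times\{0\})\cup([4]\times\{4\})$. Then \[ \lim_{n\to\infty}\frac{s_n^+(p)}{n!}=1. \]
   Context: For $n\ge1$, $S_n$ is the set of permutations of $\{1,\dots,n\}$ in one-line notation $\tau=\tau_1\cdots\tau_n$. For an integer $k\ge0$ write $[k]=\{0,1,\dots,k\}$. A mesh pattern of length $k$ is a pair $(\pi,R)$ with $\pi\in S_k$ and $R\subseteq[k]\times[k]$; the elements $(x,y)\in R$ are the shaded boxes (box $(x,y)$ is the unit square with south-west corner $(x,y)$ in the plot of the points $(i,\pi_i)$). An occurrence of $(\pi,R)$ in $\tau\in S_n$ is a choice of positions $i_1<\dots<i_k$ such that $\tau_{i_a}<\tau_{i_b}$ iff $\pi_a<\pi_b$ for all $a,b$, and such that for every $(x,y)\in R$ there is no index $m$ with $i_x<m<i_{x+1}$ and $v_y<\tau_m<v_{y+1}$, where $i_0=0$, $i_{k+1}=n+1$, $v_0=0$, $v_{k+1}=n+1$, and for $1\le y\le k$, $v_y$ is the $y$-th smallest of the values $\tau_{i_1},\dots,\tau_{i_k}$. A permutation contains a mesh pattern if it has at least one occurrence of it, and $s_n^+(p)$ denotes the number of permutations in $S_n$ containing $p$. -}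

module Defs where

open import Data.Nat using (ℕ; zero; suc; _+_; _*_; _∸_; _≤_; _<_; _<ᵇ_; _≡ᵇ_; ∣_-_∣)
open import Data.Bool using (Bool; true; false; _∧_; _∨_; not; if_then_else_)
open import Data.List using (List; []; _∷_; _++_; map; upTo; allFin; length; concatMap)
open import Data.Fin using (Fin; toℕ)
open import Data.Product using (∃-syntax)

_==_ : ℕ → ℕ → Bool
a == b = a ≡ᵇ b

all : {A : Set} → (A → Bool) → List A → Bool
all p [] = true
all p (x ∷ xs) = p x ∧ all p xs

any : {A : Set} → (A → Bool) → List A → Bool
any p [] = false
any p (x ∷ xs) = p x ∨ any p xs

_⇔ᵇ_ : Bool → Bool → Bool
true ⇔ᵇ true = true
false ⇔ᵇ false = true
_ ⇔ᵇ _ = false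

-- range a b = [a, a+1, ..., b]  (empty if b < a)
range : ℕ → ℕ → List ℕ
range a b = map (a +_) (upTo (suc b ∸ a))

-- 0-based lookup with default 0
ix : List ℕ → ℕ → ℕ
ix [] _ = 0
ix (x ∷ xs) zero = x
ix (x ∷ xs) (suc i) = ix xs i

-- 1-based lookup: at xs i = i-th entry of xs (i ≥ 1)
at : List ℕ → ℕ → ℕ
at xs i = ix xs (i ∸ 1)

insert : ℕ → List ℕ → List ℕ
insert x [] = x ∷ []
insert x (y ∷ ys) = if x <ᵇ suc y then x ∷ y ∷ ys else y ∷ insert x ys

sort : List ℕ → List ℕ
sort [] = []
sort (x ∷ xs) = insert x (sort xs)

choose : {A : Set} → ℕ → List A → List (List A)
choose zero _ = [] ∷ []
choose (suc k) [] = []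
choose (suc k) (x ∷ xs) = map (x ∷_) (choose k xs) ++ choose (suc k) xs

tuples : ℕ → ℕ → List (List ℕ)
tuples zero m = [] ∷ []
tuples (suc n) m = concatMap (λ v → map (v ∷_) (tuples n m)) (range 1 m)

isPerm : ℕ → List ℕ → Bool
isPerm n τ =
  (length τ == n)
  ∧ all (λ v → (1 ≤ᵇ v) ∧ (v ≤ᵇ n)) τ
  ∧ all (λ a → all (λ b → (a == b) ∨ not (at τ a == at τ b)) (range 1 n)) (range 1 n)
  where
  _≤ᵇ_ : ℕ → ℕ → Bool
  a ≤ᵇ b = a <ᵇ suc b

count : {A : Set} → (A → Bool) → List A → ℕ
count p [] = 0
count p (x ∷ xs) = (if p x then 1 else 0) + count p xs

-- A mesh pattern of length k: π ∈ S_k (one-line notation, values 1..k)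
-- and a set of shaded boxes R ⊆ [k] × [k], given as a Boolean
-- indicator on Fin (suc k) × Fin (suc k)  (box (x,y), 0 ≤ x,y ≤ k).

record MeshPattern (k : ℕ) : Set where
  constructor mesh
  field
    π : List ℕ
    R : Fin (suc k) → Fin (suc k) → Bool

open MeshPattern public

-- Is the increasing position list `is` = [i_1,…,i_k] (1-based) an
-- occurrence of the mesh pattern p in τ ∈ S_n ?
isOccurrence : (n : ℕ) → List ℕ → {k : ℕ} → MeshPattern k → List ℕ → Bool
isOccurrence n τ {k} p is = iso ∧ meshOK
  where
  I : ℕ → ℕ
  I zero = 0
  I (suc x) = if suc x <ᵇ suc k then at is (suc x) else suc n
  vs : List ℕ
  vs = sort (map (λ i → at τ i) is)
  V : ℕ → ℕ          -- v_0 = 0, v_{k+1} = n+1, v_y = y-th smallest value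
  V zero = 0
  V (suc y) = if suc y <ᵇ suc k then at vs (suc y) else suc n
  iso : Bool
  iso = all (λ a → all (λ b →
          ((at τ (at is a) <ᵇ at τ (at is b)) ⇔ᵇ (at (π p) a <ᵇ at (π p) b)))
          (range 1 k)) (range 1 k)
  boxEmpty : ℕ → ℕ → Bool
  boxEmpty x y = not (any (λ m → (I x <ᵇ m) ∧ (m <ᵇ I (suc x))
                                ∧ (V y <ᵇ at τ m) ∧ (at τ m <ᵇ V (suc y)))
                          (range 1 n))
  meshOK : Bool
  meshOK = all (λ x → all (λ y → not (R p x y) ∨ boxEmpty (toℕ x) (toℕ y))
                          (allFin (suc k))) (allFin (suc k))

contains : (n : ℕ) → List ℕ → {k : ℕ} → MeshPattern k → Bool
contains n τ {k} p = any (isOccurrence n τ p) (choose k (range 1 n))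

s⁺ : ℕ → {k : ℕ} → MeshPattern k → ℕ
s⁺ n p = count (λ τ → isPerm n τ ∧ contains n τ p) (tuples n n)

-- a n / b n → 1 as n → ∞ (for b n > 0), in ε–N form with ε = 1/(k+1):
-- |a n / b n − 1| < 1/(k+1)  ⇔  (k+1)·|a n − b n| < b n.
RatioTendsToOne : (ℕ → ℕ) → (ℕ → ℕ) → Set
RatioTendsToOne a b =
  ∀ (k : ℕ) → ∃[ N ] (∀ (n : ℕ) → N ≤ n → suc k * ∣ a n - b n ∣ < b n)

-- Let τ ∈ S_n avoid the pattern and let its maximum n sit at position p, with
-- c(c+1) < p < n for a parameter c.  Let j be the position of the minimum of τ₁ … τ_{p-1}.
-- If j > c and τ_i < τ_{p+1} for some i ≤ c, then (i, j, p, p+1) is an occurrence: the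
-- boxes in row 0 left of p+1 are empty since τ_j is the smallest of τ₁ … τ_p, and the
-- boxes in row 4 are empty since τ_p = n.  So either j ≤ c, or τ_{p+1} is below
-- τ₁ … τ_c.  Transposing two positions other than p permutes the permutations with τ_p = n,
-- so among them the minimum over a set of positions is equally likely at each position:
-- the two events have probability at most c/(p-1) ≤ 1/(c+1) and exactly 1/(c+1).  Adding
-- the c(c+1)+1 remaining positions of n, avoiders make up at most a fraction
-- (c(c+1)+1)/n + 2/(c+1) of S_n, which is below 3/(c+1) once n ≥ (c+1)(c(c+1)+1).

module Submission where

open import Defs
open import Data.Nat using (ℕ; zero; suc; pred; _+_; _*_; _∸_; _≤_; _<_; _<ᵇ_; z≤n; s≤s; _≟_; _≤?_; _!; ∣_-_∣; >-nonZero)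
open import Data.Nat.Properties hiding (_≟_; _≤?_)
open import Data.Nat.ListAction using (sum)
open import Data.Bool using (Bool; true; false; _∧_; _∨_; not; if_then_else_)
open import Data.Bool.Properties using (T-≡; ¬-not; not-injective; ∧-conicalˡ; ∧-conicalʳ; ∨-zeroʳ; ∧-identityʳ; ∧-zeroʳ)
open import Data.List using (List; []; _∷_; _++_; map; upTo; applyUpTo; length; allFin)
open import Data.List.Properties using (length-map; length-++; length-upTo; ∷-injectiveˡ; ∷-injectiveʳ; ∷ʳ-injective; map-upTo; map-∘; map-cong)
open import Data.List.Membership.Propositional using (_∈_; _∉_)
open import Data.List.Membership.Propositional.Properties
  using (∈-map⁺; ∈-map⁻; ∈-upTo⁺; ∈-upTo⁻; ∈-++⁺ˡ; ∈-++⁺ʳ; ∈-++⁻; ∈-concat⁺′; ∈-concat⁻′)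
open import Data.List.Relation.Unary.Any using (here; there; _─_)
import Data.List.Relation.Unary.All as All
import Data.List.Relation.Unary.All.Properties as All
import Data.List.Relation.Unary.AllPairs as AllPairs
import Data.List.Relation.Unary.AllPairs.Properties as AllPairs
open import Data.List.Relation.Unary.Unique.Propositional using (Unique)
import Data.List.Relation.Unary.Unique.Propositional.Properties as Unique
open import Data.Fin using (Fin; toℕ)
open import Data.Product using (∃-syntax; _×_; _,_; proj₁; proj₂)
open import Data.Sum using (_⊎_; inj₁; inj₂)
open import Data.Unit using (⊤; tt)
open import Data.Empty using (⊥)
open import Function using (_∘_; Equivalence)
open import Algebra.Properties.CommutativeSemigroup +-commutativeSemigroup using (interchange; x∙yz≈y∙xz)
open import Relation.Nullary using (¬_; yes; no; contradiction)
open import Relation.Binary.PropositionalEquality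

private
  variable
    A B : Set

∧-true : ∀ {a b} → a ≡ true → b ≡ true → a ∧ b ≡ true
∧-true refl refl = refl

∨-true⁻ : ∀ a {b} → a ∨ b ≡ true → a ≡ true ⊎ b ≡ true
∨-true⁻ true _ = inj₁ refl
∨-true⁻ false e = inj₂ e

∨-trueˡ : ∀ {a} b → a ≡ true → a ∨ b ≡ true
∨-trueˡ b refl = refl

∨-trueʳ : ∀ a {b} → b ≡ true → a ∨ b ≡ true
∨-trueʳ a refl = ∨-zeroʳ a

∨-false⁻ : ∀ a {b} → a ∨ b ≡ false → a ≡ false × b ≡ false
∨-false⁻ false e = refl , e

true≢false : true ≢ false
true≢false ()

bool-ext : ∀ {a b} → (a ≡ true → b ≡ true) → (b ≡ true → a ≡ true) → a ≡ b
bool-ext {true} f _ = sym (f refl)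
bool-ext {false} {false} _ _ = refl
bool-ext {false} {true} _ g = g refl

<ᵇ-true⇒< : ∀ {m n} → (m <ᵇ n) ≡ true → m < n
<ᵇ-true⇒< {m} {n} e = <ᵇ⇒< m n (Equivalence.from T-≡ e)

<⇒<ᵇ-true : ∀ {m n} → m < n → (m <ᵇ n) ≡ true
<⇒<ᵇ-true m<n = Equivalence.to T-≡ (<⇒<ᵇ m<n)

≤⇒<ᵇ-false : ∀ {m n} → n ≤ m → (m <ᵇ n) ≡ false
≤⇒<ᵇ-false n≤m = ¬-not (λ e → <⇒≱ (<ᵇ-true⇒< e) n≤m)

<ᵇ-false⇒≤ : ∀ {m n} → (m <ᵇ n) ≡ false → n ≤ m
<ᵇ-false⇒≤ e = ≮⇒≥ (λ m<n → true≢false (trans (sym (<⇒<ᵇ-true m<n)) e))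

==⇒≡ : ∀ {m n} → (m == n) ≡ true → m ≡ n
==⇒≡ {m} {n} e = ≡ᵇ⇒≡ m n (Equivalence.from T-≡ e)

≡⇒== : ∀ {m n} → m ≡ n → (m == n) ≡ true
≡⇒== {m} {n} m≡n = Equivalence.to T-≡ (≡⇒≡ᵇ m n m≡n)

≢⇒==-false : ∀ {m n} → m ≢ n → (m == n) ≡ false
≢⇒==-false m≢n = ¬-not (m≢n ∘ ==⇒≡)

==-false⇒≢ : ∀ {m n} → (m == n) ≡ false → m ≢ n
==-false⇒≢ e m≡n = true≢false (trans (sym (≡⇒== m≡n)) e)

module _ (P : A → Bool) where

  all-true⁻ : ∀ {xs} → all P xs ≡ true → ∀ {x} → x ∈ xs → P x ≡ true
  all-true⁻ {y ∷ ys} e (here refl) = ∧-conicalˡ (P y) _ e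
  all-true⁻ {y ∷ ys} e (there x∈) = all-true⁻ (∧-conicalʳ (P y) _ e) x∈

  all-true⁺ : ∀ xs → (∀ {x} → x ∈ xs → P x ≡ true) → all P xs ≡ true
  all-true⁺ [] _ = refl
  all-true⁺ (y ∷ ys) h = ∧-true (h (here refl)) (all-true⁺ ys (h ∘ there))

  any-true⁻ : ∀ xs → any P xs ≡ true → ∃[ x ] (x ∈ xs × P x ≡ true)
  any-true⁻ (y ∷ ys) e with ∨-true⁻ (P y) e
  ... | inj₁ Py = y , here refl , Py
  ... | inj₂ rest with any-true⁻ ys rest
  ...   | x , x∈ , Px = x , there x∈ , Px

  any-true⁺ : ∀ {xs x} → x ∈ xs → P x ≡ true → any P xs ≡ true
  any-true⁺ {y ∷ ys} (here refl) Px = ∨-trueˡ (any P ys) Px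
  any-true⁺ {y ∷ ys} (there x∈) Px = ∨-trueʳ (P y) (any-true⁺ x∈ Px)

  any-false⁺ : ∀ xs → (∀ {x} → x ∈ xs → P x ≡ false) → any P xs ≡ false
  any-false⁺ [] _ = refl
  any-false⁺ (y ∷ ys) h rewrite h (here refl) = any-false⁺ ys (h ∘ there)

  any-false⁻ : ∀ {xs} → any P xs ≡ false → ∀ {x} → x ∈ xs → P x ≡ false
  any-false⁻ e x∈ = ¬-not (λ Px → true≢false (trans (sym (any-true⁺ x∈ Px)) e))

-- Positions, ranges and tuples

InRange : ℕ → ℕ → Set
InRange n i = 1 ≤ i × i ≤ n

∈-range⁺ : ∀ {n i} → InRange n i → i ∈ range 1 n
∈-range⁺ {i = suc i} (_ , i<n) = ∈-map⁺ suc (∈-upTo⁺ i<n)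

∈-range⁻ : ∀ {n i} → i ∈ range 1 n → InRange n i
∈-range⁻ i∈ with ∈-map⁻ suc i∈
... | _ , j∈ , refl = s≤s z≤n , ∈-upTo⁻ j∈

range-unique : ∀ n → Unique (range 1 n)
range-unique n = Unique.map⁺ suc-injective (Unique.upTo⁺ n)

length-range : ∀ n → length (range 1 n) ≡ n
length-range n = trans (length-map suc (upTo n)) (length-upTo n)

tabulateRange : ℕ → (ℕ → ℕ) → List ℕ
tabulateRange n f = map f (range 1 n)

length-tabulateRange : ∀ n f → length (tabulateRange n f) ≡ n
length-tabulateRange n f = trans (length-map f (range 1 n)) (length-range n)

ix-map : ∀ (f : ℕ → ℕ) xs {j} → j < length xs → ix (map f xs) j ≡ f (ix xs j)
ix-map f (x ∷ xs) {zero} _ = refl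
ix-map f (x ∷ xs) {suc j} (s≤s j<) = ix-map f xs j<

ix-applyUpTo : ∀ (f : ℕ → ℕ) n {j} → j < n → ix (applyUpTo f n) j ≡ f j
ix-applyUpTo f (suc n) {zero} _ = refl
ix-applyUpTo f (suc n) {suc j} (s≤s j<n) = ix-applyUpTo (f ∘ suc) n j<n

at-tabulateRange : ∀ n f {i} → InRange n i → at (tabulateRange n f) i ≡ f i
at-tabulateRange n f {suc i} (_ , i<n) = begin
  ix (map f (map suc (upTo n))) i ≡⟨ ix-map f (map suc (upTo n)) (subst (i <_) (sym (length-range n)) i<n) ⟩
  f (ix (map suc (upTo n)) i)     ≡⟨ cong f (ix-map suc (upTo n) (subst (i <_) (sym (length-upTo n)) i<n)) ⟩
  f (suc (ix (upTo n) i))         ≡⟨ cong (f ∘ suc) (ix-applyUpTo (λ x → x) n i<n) ⟩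
  f (suc i)                       ∎
  where open ≡-Reasoning

at-∈ : ∀ xs {i} → InRange (length xs) i → at xs i ∈ xs
at-∈ (x ∷ xs) {suc zero} _ = here refl
at-∈ (x ∷ xs) {suc (suc i)} (_ , s≤s i<) = there (at-∈ xs (s≤s z≤n , i<))

∈⇒at : ∀ xs {v} → v ∈ xs → ∃[ i ] (InRange (length xs) i × at xs i ≡ v)
∈⇒at (x ∷ xs) (here refl) = 1 , (s≤s z≤n , s≤s z≤n) , refl
∈⇒at (x ∷ xs) (there v∈) with ∈⇒at xs v∈
... | suc i , (_ , i≤) , eq = suc (suc i) , (s≤s z≤n , s≤s i≤) , eq

at-ext : ∀ xs ys → length xs ≡ length ys → (∀ {i} → InRange (length xs) i → at xs i ≡ at ys i) → xs ≡ ys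
at-ext [] [] _ _ = refl
at-ext (x ∷ xs) (y ∷ ys) eq h =
  cong₂ _∷_ (h (s≤s z≤n , s≤s z≤n))
    (at-ext xs ys (suc-injective eq) λ { {suc i} (_ , i≤) → h (s≤s z≤n , s≤s i≤) })

ix-++ˡ : ∀ (xs ys : List ℕ) {j} → j < length xs → ix (xs ++ ys) j ≡ ix xs j
ix-++ˡ (x ∷ xs) ys {zero} _ = refl
ix-++ˡ (x ∷ xs) ys {suc j} (s≤s j<) = ix-++ˡ xs ys j<

ix-++ʳ : ∀ (xs ys : List ℕ) j → ix (xs ++ ys) (length xs + j) ≡ ix ys j
ix-++ʳ [] ys j = refl
ix-++ʳ (x ∷ xs) ys j = ix-++ʳ xs ys j

at-∷ʳ-last : ∀ τ x → at (τ ++ x ∷ []) (suc (length τ)) ≡ x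
at-∷ʳ-last τ x = trans (cong (ix (τ ++ x ∷ [])) (sym (+-identityʳ (length τ)))) (ix-++ʳ τ (x ∷ []) 0)

at-∷ʳ : ∀ τ x {i} → InRange (length τ) i → at (τ ++ x ∷ []) i ≡ at τ i
at-∷ʳ τ x {suc i} (_ , i<) = ix-++ˡ τ (x ∷ []) i<

at-∷ʳ-view : ∀ {n} τ x {i} → length τ ≡ n → InRange (suc n) i →
  (InRange n i × at (τ ++ x ∷ []) i ≡ at τ i) ⊎ (i ≡ suc n × at (τ ++ x ∷ []) i ≡ x)
at-∷ʳ-view τ x refl (1≤i , i≤) with m≤n⇒m<n∨m≡n i≤
... | inj₁ i< = inj₁ ((1≤i , ≤-pred i<) , at-∷ʳ τ x (1≤i , ≤-pred i<))
... | inj₂ refl = inj₂ (refl , at-∷ʳ-last τ x)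

length-∷ʳ : ∀ (τ : List ℕ) x → length (τ ++ x ∷ []) ≡ suc (length τ)
length-∷ʳ τ x = trans (length-++ τ) (+-comm (length τ) 1)

AllInRange : ℕ → List ℕ → Set
AllInRange m z = ∀ {v} → v ∈ z → InRange m v

at-AllInRange : ∀ {m} xs → (∀ {i} → InRange (length xs) i → InRange m (at xs i)) → AllInRange m xs
at-AllInRange xs entries v∈ with ∈⇒at xs v∈
... | i , i∈ , refl = entries i∈

∈-tuples⁺ : ∀ k {m} z → length z ≡ k → AllInRange m z → z ∈ tuples k m
∈-tuples⁺ zero [] _ _ = here refl
∈-tuples⁺ (suc k) (v ∷ z) eq h =
  ∈-concat⁺′ (∈-map⁺ (v ∷_) (∈-tuples⁺ k z (suc-injective eq) (h ∘ there)))
             (∈-map⁺ _ (∈-range⁺ (h (here refl))))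

∈-tuples⁻ : ∀ k {m z} → z ∈ tuples k m → length z ≡ k × AllInRange m z
∈-tuples⁻ zero (here refl) = refl , λ ()
∈-tuples⁻ (suc k) {m} z∈ with ∈-concat⁻′ (map (λ v → map (v ∷_) (tuples k m)) (range 1 m)) z∈
... | zs , z∈zs , zs∈ with ∈-map⁻ _ zs∈
... | v , v∈ , refl with ∈-map⁻ (v ∷_) z∈zs
... | z' , z'∈ , refl with ∈-tuples⁻ k z'∈
... | eq , h = cong suc eq , λ { (here refl) → ∈-range⁻ v∈ ; (there w∈) → h w∈ }

tuples-unique : ∀ k m → Unique (tuples k m)
tuples-unique zero m = All.[] AllPairs.∷ AllPairs.[]
tuples-unique (suc k) m = Unique.concat⁺
  (All.map⁺ (All.universal (λ v → Unique.map⁺ ∷-injectiveʳ (tuples-unique k m)) (range 1 m)))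
  (AllPairs.map⁺ (AllPairs.map disjoint (range-unique m)))
  where
  disjoint : ∀ {v w} → v ≢ w → ∀ {z} → ¬ (z ∈ map (v ∷_) (tuples k m) × z ∈ map (w ∷_) (tuples k m))
  disjoint v≢w (z∈v , z∈w) with ∈-map⁻ _ z∈v | ∈-map⁻ _ z∈w
  ... | _ , _ , refl | _ , _ , eq = v≢w (∷-injectiveˡ eq)

range-cons : ∀ {a b} → a ≤ b → range a b ≡ a ∷ range (suc a) b
range-cons {a} {b} a≤b rewrite +-∸-assoc 1 a≤b = cong₂ _∷_ (+-identityʳ a) (begin
  map (a +_) (applyUpTo suc (b ∸ a))     ≡⟨ cong (map (a +_)) (sym (map-upTo suc (b ∸ a))) ⟩
  map (a +_) (map suc (upTo (b ∸ a)))    ≡⟨ sym (map-∘ (upTo (b ∸ a))) ⟩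
  map (λ x → a + suc x) (upTo (b ∸ a))   ≡⟨ map-cong (+-suc a) (upTo (b ∸ a)) ⟩
  map (suc a +_) (upTo (b ∸ a))          ∎)
  where open ≡-Reasoning

Increasing : ℕ → ℕ → List ℕ → Set
Increasing a b [] = ⊤
Increasing a b (y ∷ ys) = a ≤ y × y ≤ b × Increasing (suc y) b ys

∈-choose-range : ∀ {a b} ys → Increasing a b ys → ys ∈ choose (length ys) (range a b)
∈-choose-range {a} {b} ys inc = go (suc b ∸ a) refl ys inc
  where
  shrink : ∀ {a fuel} → a ≤ b → suc b ∸ a ≡ suc fuel → suc b ∸ suc a ≡ fuel
  shrink a≤b e = suc-injective (trans (sym (+-∸-assoc 1 a≤b)) e)
  go : ∀ fuel {a} → suc b ∸ a ≡ fuel → ∀ ys → Increasing a b ys → ys ∈ choose (length ys) (range a b)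
  go _ _ [] _ = here refl
  go zero e (y ∷ ys) (a≤y , y≤b , _) = contradiction (≤-trans (m∸n≡0⇒m≤n e) (≤-trans a≤y y≤b)) (<-irrefl refl)
  go (suc fuel) {a} e (y ∷ ys) (a≤y , y≤b , inc) rewrite range-cons (≤-trans a≤y y≤b) with m≤n⇒m<n∨m≡n a≤y
  ... | inj₂ refl = ∈-++⁺ˡ (∈-map⁺ (y ∷_) (go fuel (shrink (≤-trans a≤y y≤b) e) ys inc))
  ... | inj₁ a<y = ∈-++⁺ʳ (map (a ∷_) (choose (length ys) (range (suc a) b)))
                          (go fuel (shrink (≤-trans a≤y y≤b) e) (y ∷ ys) (a<y , y≤b , inc))

-- Counting in lists

𝟙 : Bool → ℕ
𝟙 b = if b then 1 else 0

sum-map-+ : ∀ (f g : A → ℕ) xs → sum (map (λ x → f x + g x) xs) ≡ sum (map f xs) + sum (map g xs)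
sum-map-+ f g [] = refl
sum-map-+ f g (x ∷ xs) rewrite sum-map-+ f g xs = interchange (f x) (g x) _ _

sum-map-const : ∀ c (xs : List A) → sum (map (λ _ → c) xs) ≡ length xs * c
sum-map-const c [] = refl
sum-map-const c (x ∷ xs) = cong (c +_) (sum-map-const c xs)

sum-map-cong : ∀ (f g : A → ℕ) xs → (∀ {x} → x ∈ xs → f x ≡ g x) → sum (map f xs) ≡ sum (map g xs)
sum-map-cong f g [] _ = refl
sum-map-cong f g (x ∷ xs) h = cong₂ _+_ (h (here refl)) (sum-map-cong f g xs (h ∘ there))

sum-map-mono : ∀ (f g : A → ℕ) xs → (∀ {x} → x ∈ xs → f x ≤ g x) → sum (map f xs) ≤ sum (map g xs)
sum-map-mono f g [] _ = z≤n
sum-map-mono f g (x ∷ xs) h = +-mono-≤ (h (here refl)) (sum-map-mono f g xs (h ∘ there))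

*-distribˡ-sum-map : ∀ c (f : A → ℕ) xs → c * sum (map f xs) ≡ sum (map (λ x → c * f x) xs)
*-distribˡ-sum-map c f [] = *-zeroʳ c
*-distribˡ-sum-map c f (x ∷ xs) = trans (*-distribˡ-+ c (f x) _) (cong (c * f x +_) (*-distribˡ-sum-map c f xs))

sum-map-if : ∀ (b : A → Bool) u v xs →
  sum (map (λ x → if b x then u else v) xs) ≤ count b xs * u + length xs * v
sum-map-if b u v [] = z≤n
sum-map-if b u v (x ∷ xs) with b x
... | true = begin
  u + sum (map _ xs)                   ≤⟨ +-monoʳ-≤ u (sum-map-if b u v xs) ⟩
  u + (count b xs * u + length xs * v) ≡⟨ sym (+-assoc u _ _) ⟩
  u + count b xs * u + length xs * v   ≤⟨ +-monoʳ-≤ _ (m≤n+m (length xs * v) v) ⟩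
  u + count b xs * u + (v + length xs * v) ∎
  where open ≤-Reasoning
... | false = begin
  v + sum (map _ xs)                   ≤⟨ +-monoʳ-≤ v (sum-map-if b u v xs) ⟩
  v + (count b xs * u + length xs * v) ≡⟨ x∙yz≈y∙xz v (count b xs * u) (length xs * v) ⟩
  count b xs * u + (v + length xs * v) ∎
  where open ≤-Reasoning

count-as-sum : ∀ (P : A → Bool) xs → count P xs ≡ sum (map (𝟙 ∘ P) xs)
count-as-sum P [] = refl
count-as-sum P (x ∷ xs) = cong (𝟙 (P x) +_) (count-as-sum P xs)

count-mono : ∀ (P Q : A → Bool) xs → (∀ {x} → x ∈ xs → P x ≡ true → Q x ≡ true) → count P xs ≤ count Q xs
count-mono P Q [] _ = z≤n
count-mono P Q (x ∷ xs) h with P x in Px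
... | true rewrite h (here refl) Px = s≤s (count-mono P Q xs (h ∘ there))
... | false = ≤-trans (count-mono P Q xs (h ∘ there)) (m≤n+m _ (𝟙 (Q x)))

count-cong : ∀ (P Q : A → Bool) xs → (∀ {x} → x ∈ xs → P x ≡ Q x) → count P xs ≡ count Q xs
count-cong P Q [] _ = refl
count-cong P Q (x ∷ xs) h = cong₂ _+_ (cong 𝟙 (h (here refl))) (count-cong P Q xs (h ∘ there))

count-true : ∀ (xs : List A) → count (λ _ → true) xs ≡ length xs
count-true [] = refl
count-true (x ∷ xs) = cong suc (count-true xs)

count-false : ∀ (P : A → Bool) xs → (∀ {x} → x ∈ xs → P x ≡ false) → count P xs ≡ 0
count-false P [] _ = refl
count-false P (x ∷ xs) h rewrite h (here refl) = count-false P xs (h ∘ there)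

count-split : ∀ (P Q : A → Bool) xs →
  count P xs ≡ count (λ x → P x ∧ Q x) xs + count (λ x → P x ∧ not (Q x)) xs
count-split P Q [] = refl
count-split P Q (x ∷ xs) with P x | Q x
... | true | true = cong suc (count-split P Q xs)
... | true | false = trans (cong suc (count-split P Q xs)) (sym (+-suc _ _))
... | false | _ = count-split P Q xs

count-∨ : ∀ (P Q : A → Bool) xs → count (λ x → P x ∨ Q x) xs ≤ count P xs + count Q xs
count-∨ P Q [] = z≤n
count-∨ P Q (x ∷ xs) with P x | Q x
... | true | _ = s≤s (≤-trans (count-∨ P Q xs) (+-monoʳ-≤ (count P xs) (m≤n+m _ _)))
... | false | true = ≤-trans (s≤s (count-∨ P Q xs)) (≤-reflexive (sym (+-suc _ _)))
... | false | false = count-∨ P Q xs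

count-union : ∀ (E : B → A → Bool) rs xs →
  count (λ x → any (λ r → E r x) rs) xs ≤ sum (map (λ r → count (E r) xs) rs)
count-union E [] xs = ≤-reflexive (count-false _ xs (λ _ → refl))
count-union E (r ∷ rs) xs =
  ≤-trans (count-∨ (E r) _ xs) (+-monoʳ-≤ (count (E r) xs) (count-union E rs xs))

count-fibres : ∀ (P : A → Bool) (E : B → A → Bool) rs xs →
  (∀ {x} → x ∈ xs → count (λ r → E r x) rs ≡ 𝟙 (P x)) →
  count P xs ≡ sum (map (λ r → count (E r) xs) rs)
count-fibres P E rs [] _ = sym (trans (sum-map-const 0 rs) (*-zeroʳ (length rs)))
count-fibres P E rs (x ∷ xs) h = begin
  𝟙 (P x) + count P xs
    ≡⟨ cong₂ _+_ (sym (h (here refl))) (count-fibres P E rs xs (h ∘ there)) ⟩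
  count (λ r → E r x) rs + sum (map (λ r → count (E r) xs) rs)
    ≡⟨ cong (_+ sum (map (λ r → count (E r) xs) rs)) (count-as-sum (λ r → E r x) rs) ⟩
  sum (map (λ r → 𝟙 (E r x)) rs) + sum (map (λ r → count (E r) xs) rs)
    ≡⟨ sym (sum-map-+ (λ r → 𝟙 (E r x)) (λ r → count (E r) xs) rs) ⟩
  sum (map (λ r → count (E r) (x ∷ xs)) rs) ∎
  where open ≡-Reasoning

count-─ : ∀ (Q : A → Bool) {ys y} (y∈ : y ∈ ys) → count Q ys ≡ 𝟙 (Q y) + count Q (ys ─ y∈)
count-─ Q (here refl) = refl
count-─ Q {y' ∷ ys} {y} (there y∈) rewrite count-─ Q y∈ = x∙yz≈y∙xz (𝟙 (Q y')) (𝟙 (Q y)) (count Q (ys ─ y∈))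

∈-─ : ∀ {ys : List A} {y z} (y∈ : y ∈ ys) → z ∈ ys → z ≢ y → z ∈ (ys ─ y∈)
∈-─ (here refl) (here refl) z≢y = contradiction refl z≢y
∈-─ (here refl) (there z∈) _ = z∈
∈-─ (there y∈) (here refl) _ = here refl
∈-─ (there y∈) (there z∈) z≢y = there (∈-─ y∈ z∈ z≢y)

count-≤-injection : ∀ (P : A → Bool) (Q : B → Bool) (g : A → B) {xs} ys → Unique xs →
  (∀ {x} → x ∈ xs → P x ≡ true → g x ∈ ys × Q (g x) ≡ true) →
  (∀ {x y} → x ∈ xs → y ∈ xs → P x ≡ true → P y ≡ true → g x ≡ g y → x ≡ y) →
  count P xs ≤ count Q ys
count-≤-injection P Q g ys AllPairs.[] _ _ = z≤n
count-≤-injection P Q g {x ∷ xs} ys (x∉ AllPairs.∷ uniq) maps inj with P x in Px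
... | false = count-≤-injection P Q g ys uniq (maps ∘ there) (λ y∈ z∈ → inj (there y∈) (there z∈))
... | true with maps (here refl) Px
... | gx∈ys , Qgx rewrite count-─ Q gx∈ys | Qgx =
  s≤s (count-≤-injection P Q g (ys ─ gx∈ys) uniq
    (λ z∈ Pz → ∈-─ gx∈ys (proj₁ (maps (there z∈) Pz))
                 (λ gz≡gx → All.lookup x∉ z∈ (sym (inj (there z∈) (here refl) Pz Px gz≡gx)))
             , proj₂ (maps (there z∈) Pz))
    (λ y∈ z∈ → inj (there y∈) (there z∈)))

count-≤-⊆ : ∀ (P Q : A → Bool) {xs} ys → Unique xs →
  (∀ {x} → x ∈ xs → P x ≡ true → x ∈ ys × Q x ≡ true) → count P xs ≤ count Q ys
count-≤-⊆ P Q ys uniq maps = count-≤-injection P Q (λ x → x) ys uniq maps (λ _ _ _ _ x≡y → x≡y)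

count-unique : ∀ (P : A → Bool) {xs x} → Unique xs → x ∈ xs → P x ≡ true →
  (∀ {y} → y ∈ xs → P y ≡ true → y ≡ x) → count P xs ≡ 1
count-unique P {xs} {x} uniq x∈ Px only = ≤-antisym
  (count-≤-⊆ P (λ _ → true) (x ∷ []) uniq (λ y∈ Py → subst (_∈ x ∷ []) (sym (only y∈ Py)) (here refl) , refl))
  (subst (_≤ count P xs) (cong (_+ 0) (cong 𝟙 Px))
    (count-≤-⊆ P P xs (All.[] AllPairs.∷ AllPairs.[]) λ { (here refl) Py → x∈ , Py }))

count-involution : ∀ (P : A → Bool) (f : A → A) {xs} → Unique xs →
  (∀ {x} → x ∈ xs → f x ∈ xs) → (∀ {x} → x ∈ xs → f (f x) ≡ x) → count P xs ≡ count (P ∘ f) xs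
count-involution P f {xs} uniq closed invol = ≤-antisym
  (count-≤-injection P (P ∘ f) f xs uniq (λ x∈ Px → closed x∈ , subst (λ y → P y ≡ true) (sym (invol x∈)) Px)
    (λ x∈ y∈ _ _ → f-injective x∈ y∈))
  (count-≤-injection (P ∘ f) P f xs uniq (λ x∈ Pfx → closed x∈ , Pfx) (λ x∈ y∈ _ _ → f-injective x∈ y∈))
  where
  f-injective : ∀ {x y} → x ∈ xs → y ∈ xs → f x ≡ f y → x ≡ y
  f-injective x∈ y∈ eq = trans (sym (invol x∈)) (trans (cong f eq) (invol y∈))

-- Permutations and transpositions of positions

record IsPerm (n : ℕ) (τ : List ℕ) : Set where
  field
    length≡ : length τ ≡ n
    inRange : ∀ {i} → InRange n i → InRange n (at τ i)
    injective : ∀ {a b} → InRange n a → InRange n b → at τ a ≡ at τ b → a ≡ b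
open IsPerm

isPerm-AllInRange : ∀ {n τ} → IsPerm n τ → AllInRange n τ
isPerm-AllInRange {τ = τ} π = at-AllInRange τ λ i∈ → inRange π (subst (λ m → InRange m _) (length≡ π) i∈)

isPerm-true⁻ : ∀ {n τ} → isPerm n τ ≡ true → IsPerm n τ
isPerm-true⁻ {n} {τ} e = record { length≡ = ==⇒≡ length-ok ; inRange = values-ok ; injective = injective-ok }
  where
  length-ok : (length τ == n) ≡ true
  length-ok = ∧-conicalˡ (length τ == n) _ e
  range-ok : all (λ v → (1 <ᵇ suc v) ∧ (v <ᵇ suc n)) τ ≡ true
  range-ok = ∧-conicalˡ _ _ (∧-conicalʳ (length τ == n) _ e)
  distinct-ok : all (λ a → all (λ b → (a == b) ∨ not (at τ a == at τ b)) (range 1 n)) (range 1 n) ≡ true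
  distinct-ok = ∧-conicalʳ _ _ (∧-conicalʳ (length τ == n) _ e)
  values-ok : ∀ {i} → InRange n i → InRange n (at τ i)
  values-ok {i} (1≤i , i≤n) with all-true⁻ _ range-ok (at-∈ τ (1≤i , subst (i ≤_) (sym (==⇒≡ length-ok)) i≤n))
  ... | ok = ≤-pred (<ᵇ-true⇒< (∧-conicalˡ _ _ ok)) , ≤-pred (<ᵇ-true⇒< (∧-conicalʳ (1 <ᵇ suc (at τ i)) _ ok))
  injective-ok : ∀ {a b} → InRange n a → InRange n b → at τ a ≡ at τ b → a ≡ b
  injective-ok {a} {b} a∈ b∈ eq
    with ∨-true⁻ (a == b) (all-true⁻ _ (all-true⁻ _ distinct-ok (∈-range⁺ a∈)) (∈-range⁺ b∈))
  ... | inj₁ a==b = ==⇒≡ a==b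
  ... | inj₂ ne = contradiction (≡⇒== eq) (λ e′ → true≢false (trans (sym e′) (not-injective ne)))

isPerm-true⁺ : ∀ {n τ} → IsPerm n τ → isPerm n τ ≡ true
isPerm-true⁺ {n} {τ} π = ∧-true (≡⇒== (length≡ π)) (∧-true range-ok distinct-ok)
  where
  range-ok : all (λ v → (1 <ᵇ suc v) ∧ (v <ᵇ suc n)) τ ≡ true
  range-ok = all-true⁺ _ τ λ v∈ →
    let (1≤v , v≤n) = isPerm-AllInRange π v∈ in
    ∧-true (<⇒<ᵇ-true (s≤s 1≤v)) (<⇒<ᵇ-true (s≤s v≤n))
  distinct-ok : all (λ a → all (λ b → (a == b) ∨ not (at τ a == at τ b)) (range 1 n)) (range 1 n) ≡ true
  distinct-ok = all-true⁺ _ (range 1 n) λ a∈ → all-true⁺ _ (range 1 n) λ b∈ → pair (∈-range⁻ a∈) (∈-range⁻ b∈)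
    where
    pair : ∀ {a b} → InRange n a → InRange n b → ((a == b) ∨ not (at τ a == at τ b)) ≡ true
    pair {a} {b} a∈ b∈ with a ≟ b
    ... | yes a≡b = ∨-trueˡ _ (≡⇒== a≡b)
    ... | no a≢b = ∨-trueʳ (a == b) (cong not (≢⇒==-false (a≢b ∘ injective π a∈ b∈)))

isPerm⇒∈tuples : ∀ {n τ} → IsPerm n τ → τ ∈ tuples n n
isPerm⇒∈tuples {n} {τ} π = ∈-tuples⁺ n τ (length≡ π) (isPerm-AllInRange π)

transpose : ℕ → ℕ → ℕ → ℕ
transpose a b i = if i == a then b else if i == b then a else i

transpose-≢a : ∀ a b i → (i == a) ≡ false → transpose a b i ≡ (if i == b then a else i)
transpose-≢a a b i e = cong (λ c → if c then b else (if i == b then a else i)) e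

data TransposeView (a b i : ℕ) : Set where
  at-a : i ≡ a → transpose a b i ≡ b → TransposeView a b i
  at-b : i ≢ a → i ≡ b → transpose a b i ≡ a → TransposeView a b i
  elsewhere : i ≢ a → i ≢ b → transpose a b i ≡ i → TransposeView a b i

transpose-view : ∀ a b i → TransposeView a b i
transpose-view a b i with i == a in i==a
... | true = at-a (==⇒≡ i==a) (cong (λ c → if c then b else (if i == b then a else i)) i==a)
... | false with i == b in i==b
...   | true = at-b (==-false⇒≢ i==a) (==⇒≡ i==b) (trans (transpose-≢a a b i i==a) (cong (λ c → if c then a else i) i==b))
...   | false = elsewhere (==-false⇒≢ i==a) (==-false⇒≢ i==b) (trans (transpose-≢a a b i i==a) (cong (λ c → if c then a else i) i==b))

transpose-a : ∀ a b → transpose a b a ≡ b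
transpose-a a b with transpose-view a b a
... | at-a _ eq = eq
... | at-b a≢a _ _ = contradiction refl a≢a
... | elsewhere a≢a _ _ = contradiction refl a≢a

transpose-b : ∀ a b → transpose a b b ≡ a
transpose-b a b with transpose-view a b b
... | at-a refl eq = eq
... | at-b _ _ eq = eq
... | elsewhere _ b≢b _ = contradiction refl b≢b

transpose-involutive : ∀ a b i → transpose a b (transpose a b i) ≡ i
transpose-involutive a b i with transpose-view a b i
... | at-a refl eq rewrite eq = transpose-b a b
... | at-b _ refl eq rewrite eq = transpose-a a b
... | elsewhere _ _ eq rewrite eq = eq

transpose-injective : ∀ a b {i j} → transpose a b i ≡ transpose a b j → i ≡ j
transpose-injective a b {i} {j} eq = begin
  i                                 ≡⟨ sym (transpose-involutive a b i) ⟩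
  transpose a b (transpose a b i)   ≡⟨ cong (transpose a b) eq ⟩
  transpose a b (transpose a b j)   ≡⟨ transpose-involutive a b j ⟩
  j                                 ∎
  where open ≡-Reasoning

transpose-closed : ∀ (S : ℕ → Set) {a b i} → S a → S b → S i → S (transpose a b i)
transpose-closed S {a} {b} {i} Sa Sb Si with transpose-view a b i
... | at-a _ eq = subst S (sym eq) Sb
... | at-b _ _ eq = subst S (sym eq) Sa
... | elsewhere _ _ eq = subst S (sym eq) Si

transpose-fixes : ∀ {a b i} → i ≢ a → i ≢ b → transpose a b i ≡ i
transpose-fixes {a} {b} {i} i≢a i≢b with transpose-view a b i
... | at-a i≡a _ = contradiction i≡a i≢a
... | at-b _ i≡b _ = contradiction i≡b i≢b
... | elsewhere _ _ eq = eq

swapPositions : ℕ → ℕ → ℕ → List ℕ → List ℕ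
swapPositions n a b τ = tabulateRange n (at τ ∘ transpose a b)

module _ {n a b : ℕ} (a∈ : InRange n a) (b∈ : InRange n b) where

  at-swapPositions : ∀ τ {i} → InRange n i → at (swapPositions n a b τ) i ≡ at τ (transpose a b i)
  at-swapPositions τ = at-tabulateRange n (at τ ∘ transpose a b)

  length-swapPositions : ∀ τ → length (swapPositions n a b τ) ≡ n
  length-swapPositions τ = length-tabulateRange n (at τ ∘ transpose a b)

  swapPositions-involutive : ∀ {τ} → length τ ≡ n → swapPositions n a b (swapPositions n a b τ) ≡ τ
  swapPositions-involutive {τ} len = at-ext σσ τ (trans (length-swapPositions σ) (sym len)) λ {i} i∈′ →
    let i∈ = subst (λ m → InRange m i) (length-swapPositions σ) i∈′ in begin
    at σσ i                                          ≡⟨ at-swapPositions σ i∈ ⟩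
    at (swapPositions n a b τ) (transpose a b i)     ≡⟨ at-swapPositions τ (transpose-closed (InRange n) a∈ b∈ i∈) ⟩
    at τ (transpose a b (transpose a b i))           ≡⟨ cong (at τ) (transpose-involutive a b i) ⟩
    at τ i                                           ∎
    where
    open ≡-Reasoning
    σ σσ : List ℕ
    σ = swapPositions n a b τ
    σσ = swapPositions n a b σ

  swapPositions-isPerm : ∀ {τ} → IsPerm n τ → IsPerm n (swapPositions n a b τ)
  swapPositions-isPerm {τ} π = record
    { length≡ = length-swapPositions τ
    ; inRange = λ i∈ → subst (InRange n) (sym (at-swapPositions τ i∈)) (inRange π (transpose-closed (InRange n) a∈ b∈ i∈))
    ; injective = λ x∈ y∈ eq → transpose-injective a b
        (injective π (transpose-closed (InRange n) a∈ b∈ x∈) (transpose-closed (InRange n) a∈ b∈ y∈)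
          (trans (sym (at-swapPositions τ x∈)) (trans eq (at-swapPositions τ y∈))))
    }

  swapPositions-∈-tuples : ∀ {τ} → τ ∈ tuples n n → swapPositions n a b τ ∈ tuples n n
  swapPositions-∈-tuples {τ} τ∈ = ∈-tuples⁺ n σ (length-swapPositions τ) (at-AllInRange σ λ i∈′ →
    let i∈ = subst (λ m → InRange m _) (length-swapPositions τ) i∈′ in
    subst (InRange n) (sym (at-swapPositions τ i∈)) (entry (transpose-closed (InRange n) a∈ b∈ i∈)))
    where
    σ : List ℕ
    σ = swapPositions n a b τ
    entry : ∀ {j} → InRange n j → InRange n (at τ j)
    entry j∈ = proj₂ (∈-tuples⁻ n τ∈) (at-∈ τ (subst (λ m → InRange m _) (sym (proj₁ (∈-tuples⁻ n τ∈))) j∈))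

-- Counting permutations

#perms : ℕ → (List ℕ → Bool) → ℕ
#perms n Q = count (λ τ → isPerm n τ ∧ Q τ) (tuples n n)

#perms-swapPositions : ∀ {n a b} → InRange n a → InRange n b → ∀ (Q : List ℕ → Bool) →
  #perms n Q ≡ #perms n (Q ∘ swapPositions n a b)
#perms-swapPositions {n} {a} {b} a∈ b∈ Q = begin
  count (λ τ → isPerm n τ ∧ Q τ) (tuples n n)
    ≡⟨ count-involution _ (swapPositions n a b) (tuples-unique n n) (swapPositions-∈-tuples a∈ b∈) involutive ⟩
  count (λ τ → isPerm n (swapPositions n a b τ) ∧ Q (swapPositions n a b τ)) (tuples n n)
    ≡⟨ count-cong _ _ (tuples n n) (λ {τ} τ∈ → cong (_∧ Q (swapPositions n a b τ)) (isPerm-invariant τ∈)) ⟩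
  count (λ τ → isPerm n τ ∧ Q (swapPositions n a b τ)) (tuples n n) ∎
  where
  open ≡-Reasoning
  involutive : ∀ {τ} → τ ∈ tuples n n → swapPositions n a b (swapPositions n a b τ) ≡ τ
  involutive τ∈ = swapPositions-involutive a∈ b∈ (proj₁ (∈-tuples⁻ n τ∈))
  isPerm-invariant : ∀ {τ} → τ ∈ tuples n n → isPerm n (swapPositions n a b τ) ≡ isPerm n τ
  isPerm-invariant {τ} τ∈ = bool-ext
    (λ e → subst (λ σ → isPerm n σ ≡ true) (involutive τ∈)
                 (isPerm-true⁺ (swapPositions-isPerm a∈ b∈ (isPerm-true⁻ {n} {swapPositions n a b τ} e))))
    (λ e → isPerm-true⁺ (swapPositions-isPerm a∈ b∈ (isPerm-true⁻ {n} {τ} e)))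

#perms-cong : ∀ {n} (Q Q′ : List ℕ → Bool) → (∀ {τ} → IsPerm n τ → Q τ ≡ Q′ τ) → #perms n Q ≡ #perms n Q′
#perms-cong {n} Q Q′ h = count-cong _ _ (tuples n n) λ {τ} _ → lemma τ
  where
  lemma : ∀ τ → (isPerm n τ ∧ Q τ) ≡ (isPerm n τ ∧ Q′ τ)
  lemma τ with isPerm n τ in e
  ... | true = h (isPerm-true⁻ e)
  ... | false = refl

#perms-mono : ∀ {n} (Q Q′ : List ℕ → Bool) → (∀ {τ} → IsPerm n τ → Q τ ≡ true → Q′ τ ≡ true) → #perms n Q ≤ #perms n Q′
#perms-mono {n} Q Q′ h = count-mono _ _ (tuples n n) λ {τ} _ e →
  ∧-true (∧-conicalˡ _ _ e) (h (isPerm-true⁻ (∧-conicalˡ _ _ e)) (∧-conicalʳ (isPerm n τ) _ e))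

#perms-fibres : ∀ {n} (Q : List ℕ → Bool) (E : B → List ℕ → Bool) rs →
  (∀ {τ} → IsPerm n τ → count (λ r → E r τ) rs ≡ 𝟙 (Q τ)) →
  #perms n Q ≡ sum (map (λ r → #perms n (E r)) rs)
#perms-fibres {n = n} Q E rs fibre =
  count-fibres _ (λ r τ → isPerm n τ ∧ E r τ) rs (tuples n n) (λ {τ} _ → fibre′ τ)
  where
  fibre′ : ∀ τ → count (λ r → isPerm n τ ∧ E r τ) rs ≡ 𝟙 (isPerm n τ ∧ Q τ)
  fibre′ τ with isPerm n τ in e
  ... | true = fibre (isPerm-true⁻ e)
  ... | false = count-false _ rs (λ _ → refl)

#perms-fibres-uniform : ∀ {n} (Q : List ℕ → Bool) (E : B → List ℕ → Bool) rs e →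
  (∀ {τ} → IsPerm n τ → count (λ r → E r τ) rs ≡ 𝟙 (Q τ)) →
  (∀ {r} → r ∈ rs → #perms n (E r) ≡ e) → #perms n Q ≡ length rs * e
#perms-fibres-uniform {n = n} Q E rs e fibre uniform =
  trans (#perms-fibres Q E rs fibre) (trans (sum-map-cong _ _ rs uniform) (sum-map-const e rs))

#perms-union : ∀ {n} (E : B → List ℕ → Bool) rs →
  #perms n (λ τ → any (λ r → E r τ) rs) ≤ sum (map (λ r → #perms n (E r)) rs)
#perms-union {n = n} E rs = ≤-trans
  (count-mono _ _ (tuples n n) λ {τ} _ e → distribute τ (∧-conicalˡ (isPerm n τ) _ e) (∧-conicalʳ (isPerm n τ) _ e))
  (count-union (λ r τ → isPerm n τ ∧ E r τ) rs (tuples n n))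
  where
  distribute : ∀ τ → isPerm n τ ≡ true → any (λ r → E r τ) rs ≡ true → any (λ r → isPerm n τ ∧ E r τ) rs ≡ true
  distribute τ π e with any-true⁻ _ rs e
  ... | r , r∈ , Er = any-true⁺ _ r∈ (∧-true π Er)

#perms-∨ : ∀ {n} (Q Q′ : List ℕ → Bool) → #perms n (λ τ → Q τ ∨ Q′ τ) ≤ #perms n Q + #perms n Q′
#perms-∨ {n} Q Q′ = ≤-trans
  (count-mono _ _ (tuples n n) λ {τ} _ e → distribute (isPerm n τ) e)
  (count-∨ (λ τ → isPerm n τ ∧ Q τ) (λ τ → isPerm n τ ∧ Q′ τ) (tuples n n))
  where
  distribute : ∀ a {b c} → (a ∧ (b ∨ c)) ≡ true → ((a ∧ b) ∨ (a ∧ c)) ≡ true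
  distribute true e = e

valueAt : ℕ → ℕ → List ℕ → Bool
valueAt p v τ = at τ p == v

valueAt-swapPositions : ∀ {n a b p} v → InRange n a → InRange n b → InRange n p → p ≢ a → p ≢ b →
  ∀ τ → valueAt p v (swapPositions n a b τ) ≡ valueAt p v τ
valueAt-swapPositions v a∈ b∈ p∈ p≢a p≢b τ =
  cong (_== v) (trans (at-swapPositions a∈ b∈ τ p∈) (cong (at τ) (transpose-fixes p≢a p≢b)))

maximum-position : ∀ {n τ} → IsPerm (suc n) τ → ∃[ p ] (InRange (suc n) p × at τ p ≡ suc n)
maximum-position {n} {τ} π with any (λ p → valueAt p (suc n) τ) (range 1 (suc n)) in found
... | true with any-true⁻ _ (range 1 (suc n)) found
...   | p , p∈ , max = p , ∈-range⁻ p∈ , ==⇒≡ max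
maximum-position {n} {τ} π | false = contradiction pigeonhole (<⇒≱ ≤-refl)
  where
  below-max : ∀ {p} → p ∈ range 1 (suc n) → InRange n (at τ p)
  below-max p∈ with inRange π (∈-range⁻ p∈)
  ... | 1≤v , v≤1+n = 1≤v , ≤-pred (≤∧≢⇒< v≤1+n (==-false⇒≢ (any-false⁻ _ found p∈)))
  pigeonhole : suc n ≤ n
  pigeonhole = begin
    suc n                                     ≡⟨ sym (trans (count-true (range 1 (suc n))) (length-range (suc n))) ⟩
    count (λ _ → true) (range 1 (suc n))      ≤⟨ count-≤-injection (λ _ → true) (λ _ → true) (at τ) (range 1 n) (range-unique (suc n))
                                                   (λ p∈ _ → ∈-range⁺ (below-max p∈) , refl)
                                                   (λ p∈ q∈ _ _ → injective π (∈-range⁻ p∈) (∈-range⁻ q∈)) ⟩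
    count (λ _ → true) (range 1 n)            ≡⟨ trans (count-true (range 1 n)) (length-range n) ⟩
    n                                         ∎
    where open ≤-Reasoning

#perms-valueAt-swap : ∀ {n p} → InRange (suc n) p →
  #perms (suc n) (valueAt p (suc n)) ≡ #perms (suc n) (valueAt (suc n) (suc n))
#perms-valueAt-swap {n} {p} p∈ = begin
  #perms (suc n) (valueAt p (suc n))
    ≡⟨ #perms-swapPositions p∈ last∈ (valueAt p (suc n)) ⟩
  #perms (suc n) (valueAt p (suc n) ∘ swapPositions (suc n) p (suc n))
    ≡⟨ #perms-cong {suc n} _ _ (λ {τ} _ → cong (_== suc n) (trans (at-swapPositions p∈ last∈ τ p∈) (cong (at τ) (transpose-a p (suc n))))) ⟩
  #perms (suc n) (valueAt (suc n) (suc n)) ∎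
  where
  open ≡-Reasoning
  last∈ : InRange (suc n) (suc n)
  last∈ = s≤s z≤n , ≤-refl

∷ʳ-max-isPerm : ∀ {n τ} → IsPerm n τ → IsPerm (suc n) (τ ++ suc n ∷ [])
∷ʳ-max-isPerm {n} {τ} π = record
  { length≡ = trans (length-∷ʳ τ (suc n)) (cong suc (length≡ π))
  ; inRange = values
  ; injective = distinct
  }
  where
  view : ∀ {i} → InRange (suc n) i → (InRange n i × at (τ ++ suc n ∷ []) i ≡ at τ i) ⊎ (i ≡ suc n × at (τ ++ suc n ∷ []) i ≡ suc n)
  view = at-∷ʳ-view τ (suc n) (length≡ π)
  values : ∀ {i} → InRange (suc n) i → InRange (suc n) (at (τ ++ suc n ∷ []) i)
  values i∈ with view i∈
  ... | inj₁ (i∈′ , eq) rewrite eq = proj₁ (inRange π i∈′) , m≤n⇒m≤1+n (proj₂ (inRange π i∈′))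
  ... | inj₂ (_ , eq) rewrite eq = s≤s z≤n , ≤-refl
  below : ∀ {i} → InRange n i → at τ i ≢ suc n
  below i∈ eq = <-irrefl eq (s≤s (proj₂ (inRange π i∈)))
  distinct : ∀ {a b} → InRange (suc n) a → InRange (suc n) b →
    at (τ ++ suc n ∷ []) a ≡ at (τ ++ suc n ∷ []) b → a ≡ b
  distinct a∈ b∈ eq with view a∈ | view b∈
  ... | inj₁ (a∈′ , ea) | inj₁ (b∈′ , eb) = injective π a∈′ b∈′ (trans (sym ea) (trans eq eb))
  ... | inj₁ (a∈′ , ea) | inj₂ (_ , eb) = contradiction (trans (sym ea) (trans eq eb)) (below a∈′)
  ... | inj₂ (_ , ea) | inj₁ (b∈′ , eb) = contradiction (trans (sym eb) (trans (sym eq) ea)) (below b∈′)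
  ... | inj₂ (a≡ , _) | inj₂ (b≡ , _) = trans a≡ (sym b≡)

module _ {n y} (π : IsPerm (suc n) y) (last-max : at y (suc n) ≡ suc n) where

  private
    init : List ℕ
    init = tabulateRange n (at y)
    last∈ : InRange (suc n) (suc n)
    last∈ = s≤s z≤n , ≤-refl
    widen : ∀ {i} → InRange n i → InRange (suc n) i
    widen (1≤i , i≤n) = 1≤i , m≤n⇒m≤1+n i≤n

  init-isPerm : IsPerm n (tabulateRange n (at y))
  init-isPerm = record
    { length≡ = length-tabulateRange n (at y)
    ; inRange = λ i∈ → subst (InRange n) (sym (at-tabulateRange n (at y) i∈)) (not-last i∈)
    ; injective = λ a∈ b∈ eq → injective π (widen a∈) (widen b∈)
        (trans (sym (at-tabulateRange n (at y) a∈)) (trans eq (at-tabulateRange n (at y) b∈)))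
    }
    where
    not-last : ∀ {i} → InRange n i → InRange n (at y i)
    not-last {i} i∈ with inRange π (widen i∈)
    ... | 1≤v , v≤ = 1≤v , ≤-pred (≤∧≢⇒< v≤ λ v≡ →
          <-irrefl (injective π (widen i∈) last∈ (trans v≡ (sym last-max))) (s≤s (proj₂ i∈)))

  init-∷ʳ-max : tabulateRange n (at y) ++ suc n ∷ [] ≡ y
  init-∷ʳ-max = at-ext _ y (trans length-snoc (sym (length≡ π))) λ i∈′ →
    case (at-∷ʳ-view init (suc n) (length-tabulateRange n (at y)) (subst (λ m → InRange m _) length-snoc i∈′))
    where
    length-snoc : length (init ++ suc n ∷ []) ≡ suc n
    length-snoc = trans (length-∷ʳ init (suc n)) (cong suc (length-tabulateRange n (at y)))
    case : ∀ {i} → (InRange n i × at (init ++ suc n ∷ []) i ≡ at init i) ⊎ (i ≡ suc n × at (init ++ suc n ∷ []) i ≡ suc n) →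
      at (init ++ suc n ∷ []) i ≡ at y i
    case (inj₁ (i∈ , eq)) = trans eq (at-tabulateRange n (at y) i∈)
    case (inj₂ (refl , eq)) = trans eq (sym last-max)

#perms-max-last : ∀ n → #perms (suc n) (valueAt (suc n) (suc n)) ≡ #perms n (λ _ → true)
#perms-max-last n = ≤-antisym
  (count-≤-injection max-last perm (tabulateRange n ∘ at) (tuples n n) (tuples-unique (suc n) (suc n)) init-maps init-injective)
  (count-≤-injection perm max-last (_++ suc n ∷ []) (tuples (suc n) (suc n)) (tuples-unique n n) snoc-maps snoc-injective)
  where
  perm max-last : List ℕ → Bool
  perm τ = isPerm n τ ∧ true
  max-last y = isPerm (suc n) y ∧ valueAt (suc n) (suc n) y
  unpack : ∀ {y} → max-last y ≡ true → IsPerm (suc n) y × at y (suc n) ≡ suc n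
  unpack {y} e = isPerm-true⁻ {suc n} {y} (∧-conicalˡ _ _ e) , ==⇒≡ (∧-conicalʳ (isPerm (suc n) y) _ e)
  init-maps : ∀ {y} → y ∈ tuples (suc n) (suc n) → max-last y ≡ true →
    tabulateRange n (at y) ∈ tuples n n × perm (tabulateRange n (at y)) ≡ true
  init-maps {y} _ e with unpack {y} e
  ... | π , last = isPerm⇒∈tuples (init-isPerm π last) , ∧-true (isPerm-true⁺ (init-isPerm π last)) refl
  init-injective : ∀ {y z} → y ∈ tuples (suc n) (suc n) → z ∈ tuples (suc n) (suc n) → max-last y ≡ true → max-last z ≡ true →
    tabulateRange n (at y) ≡ tabulateRange n (at z) → y ≡ z
  init-injective {y} {z} _ _ ey ez eq with unpack {y} ey | unpack {z} ez
  ... | πy , lasty | πz , lastz =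
    trans (sym (init-∷ʳ-max πy lasty)) (trans (cong (_++ suc n ∷ []) eq) (init-∷ʳ-max πz lastz))
  snoc-maps : ∀ {τ} → τ ∈ tuples n n → perm τ ≡ true →
    (τ ++ suc n ∷ []) ∈ tuples (suc n) (suc n) × max-last (τ ++ suc n ∷ []) ≡ true
  snoc-maps {τ} _ e = isPerm⇒∈tuples (∷ʳ-max-isPerm τ-perm) , ∧-true (isPerm-true⁺ (∷ʳ-max-isPerm τ-perm)) (≡⇒== last)
    where
    τ-perm : IsPerm n τ
    τ-perm = isPerm-true⁻ (∧-conicalˡ _ _ e)
    last : at (τ ++ suc n ∷ []) (suc n) ≡ suc n
    last = subst (λ m → at (τ ++ suc n ∷ []) (suc m) ≡ suc n) (length≡ τ-perm) (at-∷ʳ-last τ (suc n))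
  snoc-injective : ∀ {τ σ} → τ ∈ tuples n n → σ ∈ tuples n n → perm τ ≡ true → perm σ ≡ true →
    τ ++ suc n ∷ [] ≡ σ ++ suc n ∷ [] → τ ≡ σ
  snoc-injective _ _ _ _ eq = proj₁ (∷ʳ-injective _ _ eq)

count-maximum-position : ∀ {n τ} → IsPerm (suc n) τ → count (λ p → valueAt p (suc n) τ) (range 1 (suc n)) ≡ 1
count-maximum-position {n} {τ} π with maximum-position π
... | p , p∈ , max = count-unique _ (range-unique (suc n)) (∈-range⁺ p∈) (≡⇒== max)
      λ q∈ e → injective π (∈-range⁻ q∈) p∈ (trans (==⇒≡ e) (sym max))

#perms-total : ∀ n → #perms n (λ _ → true) ≡ n !
#perms-total zero = refl
#perms-total (suc n) = begin
  #perms (suc n) (λ _ → true)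
    ≡⟨ #perms-fibres-uniform _ (λ p → valueAt p (suc n)) (range 1 (suc n)) _ count-maximum-position (#perms-valueAt-swap ∘ ∈-range⁻) ⟩
  length (range 1 (suc n)) * #perms (suc n) (valueAt (suc n) (suc n))
    ≡⟨ cong₂ _*_ (length-range (suc n)) (#perms-max-last n) ⟩
  suc n * #perms n (λ _ → true)
    ≡⟨ cong (suc n *_) (#perms-total n) ⟩
  suc n * n ! ∎
  where open ≡-Reasoning

#perms-by-maximum : ∀ n (Q : List ℕ → Bool) →
  #perms (suc n) Q ≡ sum (map (λ p → #perms (suc n) (λ τ → valueAt p (suc n) τ ∧ Q τ)) (range 1 (suc n)))
#perms-by-maximum n Q = #perms-fibres Q (λ p τ → valueAt p (suc n) τ ∧ Q τ) (range 1 (suc n)) fibre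
  where
  fibre : ∀ {τ} → IsPerm (suc n) τ → count (λ p → valueAt p (suc n) τ ∧ Q τ) (range 1 (suc n)) ≡ 𝟙 (Q τ)
  fibre {τ} π with Q τ
  ... | true = trans (count-cong _ _ (range 1 (suc n)) (λ _ → ∧-identityʳ _)) (count-maximum-position π)
  ... | false = count-false _ (range 1 (suc n)) (λ _ → ∧-zeroʳ _)

#perms-valueAt : ∀ {n p} → InRange (suc n) p → #perms (suc n) (valueAt p (suc n)) ≡ n !
#perms-valueAt {n} p∈ = trans (#perms-valueAt-swap p∈) (trans (#perms-max-last n) (#perms-total n))

#perms-valueAt-∧ : ∀ {n p} (Q : List ℕ → Bool) → InRange (suc n) p → #perms (suc n) (λ τ → valueAt p (suc n) τ ∧ Q τ) ≤ n !
#perms-valueAt-∧ {n} {p} Q p∈ = ≤-trans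
  (#perms-mono {suc n} _ (valueAt p (suc n)) (λ {τ} _ e → ∧-conicalˡ (valueAt p (suc n) τ) _ e))
  (≤-reflexive (#perms-valueAt p∈))

s⁺+avoiders≡n! : ∀ n {k} (P : MeshPattern k) → s⁺ n P + #perms n (λ τ → not (contains n τ P)) ≡ n !
s⁺+avoiders≡n! n P = begin
  s⁺ n P + #perms n (λ τ → not (contains n τ P)) ≡⟨ sym (count-split (isPerm n) (λ τ → contains n τ P) (tuples n n)) ⟩
  count (isPerm n) (tuples n n)                  ≡⟨ count-cong _ _ (tuples n n) (λ _ → sym (∧-identityʳ _)) ⟩
  #perms n (λ _ → true)                          ≡⟨ #perms-total n ⟩
  n !                                            ∎
  where open ≡-Reasoning

∣s⁺-n!∣≡#avoiders : ∀ n {k} (P : MeshPattern k) → ∣ s⁺ n P - n ! ∣ ≡ #perms n (λ τ → not (contains n τ P))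
∣s⁺-n!∣≡#avoiders n P =
  trans (cong (∣ s⁺ n P -_∣) (sym (s⁺+avoiders≡n! n P))) (∣m-m+n∣≡n (s⁺ n P) _)

-- Minima over a set of positions

minAt : ℕ → List ℕ → List ℕ → Bool
minAt r S τ = all (λ m → (m == r) ∨ (at τ r <ᵇ at τ m)) S

module _ {r : ℕ} {S τ : List ℕ} where

  minAt-true⁻ : minAt r S τ ≡ true → ∀ {m} → m ∈ S → m ≢ r → at τ r < at τ m
  minAt-true⁻ e m∈ m≢r with ∨-true⁻ _ (all-true⁻ _ e m∈)
  ... | inj₁ m==r = contradiction (==⇒≡ m==r) m≢r
  ... | inj₂ lt = <ᵇ-true⇒< lt

  minAt-true⁺ : (∀ {m} → m ∈ S → m ≢ r → at τ r < at τ m) → minAt r S τ ≡ true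
  minAt-true⁺ h = all-true⁺ _ S λ {m} m∈ → case m∈
    where
    case : ∀ {m} → m ∈ S → ((m == r) ∨ (at τ r <ᵇ at τ m)) ≡ true
    case {m} m∈ with m ≟ r
    ... | yes m≡r = ∨-trueˡ _ (≡⇒== m≡r)
    ... | no m≢r = ∨-trueʳ (m == r) (<⇒<ᵇ-true (h m∈ m≢r))

minAt-unique : ∀ {S τ r r′} → r ∈ S → r′ ∈ S → minAt r S τ ≡ true → minAt r′ S τ ≡ true → r′ ≡ r
minAt-unique {S} {τ} {r} {r′} r∈ r′∈ min min′ with r′ ≟ r
... | yes r′≡r = r′≡r
... | no r′≢r = contradiction (minAt-true⁻ {r} {S} {τ} min r′∈ r′≢r) (<-asym (minAt-true⁻ {r′} {S} {τ} min′ r∈ (r′≢r ∘ sym)))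

argmin : ∀ (f : ℕ → ℕ) {S r₀} → r₀ ∈ S → ∃[ r ] (r ∈ S × (∀ {m} → m ∈ S → f r ≤ f m))
argmin f {x ∷ []} _ = x , here refl , λ { (here refl) → ≤-refl }
argmin f {x ∷ y ∷ S} _ with argmin f {y ∷ S} (here refl)
... | r , r∈ , r-min with f x ≤? f r
...   | yes fx≤fr = x , here refl , λ { (here refl) → ≤-refl ; (there m∈) → ≤-trans fx≤fr (r-min m∈) }
...   | no fx≰fr = r , there r∈ , λ { (here refl) → <⇒≤ (≰⇒> fx≰fr) ; (there m∈) → r-min m∈ }

minimum-position : ∀ {n S τ r₀} → IsPerm n τ → AllInRange n S → r₀ ∈ S →
  ∃[ r ] (r ∈ S × minAt r S τ ≡ true)
minimum-position {S = S} {τ} π S⊆ r₀∈ with argmin (at τ) r₀∈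
... | r , r∈ , r-min = r , r∈ , minAt-true⁺ {r} {S} {τ} λ m∈ m≢r →
      ≤∧≢⇒< (r-min m∈) (λ eq → m≢r (sym (injective π (S⊆ r∈) (S⊆ m∈) eq)))

minAt-swapPositions : ∀ {n S r r′} → AllInRange n S → r ∈ S → r′ ∈ S →
  ∀ τ → minAt r′ S (swapPositions n r r′ τ) ≡ minAt r S τ
minAt-swapPositions {n} {S} {r} {r′} S⊆ r∈ r′∈ τ = bool-ext
  (λ e → minAt-true⁺ {r} {S} {τ} λ {m} m∈ m≢r →
    subst₂ _<_ (at-σ-r′) (trans (at-σ (t∈ m∈)) (cong (at τ) (transpose-involutive r r′ m)))
      (minAt-true⁻ {r′} {S} {σ} e (t∈ m∈) (λ t≡r′ → m≢r (transpose-injective r r′ (trans t≡r′ (sym (transpose-a r r′)))))))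
  (λ e → minAt-true⁺ {r′} {S} {σ} λ {m} m∈ m≢r′ →
    subst₂ _<_ (sym at-σ-r′) (sym (at-σ m∈))
      (minAt-true⁻ {r} {S} {τ} e (t∈ m∈) (λ t≡r → m≢r′ (transpose-injective r r′ (trans t≡r (sym (transpose-b r r′)))))))
  where
  σ : List ℕ
  σ = swapPositions n r r′ τ
  t∈ : ∀ {m} → m ∈ S → transpose r r′ m ∈ S
  t∈ m∈ = transpose-closed (_∈ S) r∈ r′∈ m∈
  at-σ : ∀ {m} → m ∈ S → at σ m ≡ at τ (transpose r r′ m)
  at-σ m∈ = at-swapPositions (S⊆ r∈) (S⊆ r′∈) τ (S⊆ m∈)
  at-σ-r′ : at σ r′ ≡ at τ r
  at-σ-r′ = trans (at-σ r′∈) (cong (at τ) (transpose-b r r′))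

SwapInvariant : ℕ → List ℕ → (List ℕ → Bool) → Set
SwapInvariant n S Q = ∀ {a b} → a ∈ S → b ∈ S → ∀ τ → Q (swapPositions n a b τ) ≡ Q τ

#perms-minAt-uniform : ∀ {n} (Q : List ℕ → Bool) {S r r′} → AllInRange n S → r ∈ S → r′ ∈ S →
  SwapInvariant n S Q → #perms n (λ τ → Q τ ∧ minAt r′ S τ) ≡ #perms n (λ τ → Q τ ∧ minAt r S τ)
#perms-minAt-uniform {n} Q {S} {r} {r′} S⊆ r∈ r′∈ Q-invariant = trans (#perms-swapPositions (S⊆ r∈) (S⊆ r′∈) _)
  (#perms-cong {n} _ _ λ {τ} _ → cong₂ _∧_ (Q-invariant r∈ r′∈ τ) (minAt-swapPositions S⊆ r∈ r′∈ τ))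

#perms-minAt : ∀ {n} (Q : List ℕ → Bool) {S r} → Unique S → AllInRange n S → r ∈ S →
  SwapInvariant n S Q → #perms n Q ≡ length S * #perms n (λ τ → Q τ ∧ minAt r S τ)
#perms-minAt {n} Q {S} {r} uniq S⊆ r∈ Q-invariant =
  #perms-fibres-uniform Q (λ r′ τ → Q τ ∧ minAt r′ S τ) S _ fibre (λ r′∈ → #perms-minAt-uniform Q S⊆ r∈ r′∈ Q-invariant)
  where
  fibre : ∀ {τ} → IsPerm n τ → count (λ r′ → Q τ ∧ minAt r′ S τ) S ≡ 𝟙 (Q τ)
  fibre {τ} π with Q τ
  ... | false = count-false _ S (λ _ → refl)
  ... | true with minimum-position π S⊆ r∈
  ...   | r₀ , r₀∈ , min = count-unique _ uniq r₀∈ min (λ r′∈ min′ → minAt-unique {S} {τ} r₀∈ r′∈ min min′)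

valueAt-SwapInvariant : ∀ {n p S} v → InRange n p → AllInRange n S → p ∉ S →
  SwapInvariant n S (valueAt p v)
valueAt-SwapInvariant v p∈ S⊆ p∉S a∈ b∈ =
  valueAt-swapPositions v (S⊆ a∈) (S⊆ b∈) p∈ (λ p≡a → p∉S (subst (_∈ _) (sym p≡a) a∈)) (λ p≡b → p∉S (subst (_∈ _) (sym p≡b) b∈))

-- Occurrences of 2143

-- The boundaries i₀ … i₅ and v₀ … v₅ of `isOccurrence` for a pattern of length 4.
extend : ℕ → List ℕ → ℕ → ℕ
extend n xs 0 = 0
extend n xs 1 = at xs 1
extend n xs 2 = at xs 2
extend n xs 3 = at xs 3
extend n xs 4 = at xs 4
extend n xs _ = suc n

boxEmpty : ℕ → List ℕ → (ℕ → ℕ) → (ℕ → ℕ) → ℕ → ℕ → Bool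
boxEmpty n τ X Y x y =
  not (any (λ m → (X x <ᵇ m) ∧ (m <ᵇ X (suc x)) ∧ (Y y <ᵇ at τ m) ∧ (at τ m <ᵇ Y (suc y))) (range 1 n))

orderIsomorphic : List ℕ → (ℕ → ℕ) → Bool
orderIsomorphic π v = all (λ a → all (λ b → (v a <ᵇ v b) ⇔ᵇ (at π a <ᵇ at π b)) (range 1 4)) (range 1 4)

isOccurrence-length4 : ∀ n τ π R is → length is ≡ 4 →
  isOccurrence n τ (mesh π R) is ≡
    orderIsomorphic π (at τ ∘ at is) ∧
    all (λ x → all (λ y → not (R x y) ∨ boxEmpty n τ (extend n is) (extend n (sort (map (at τ) is))) (toℕ x) (toℕ y))
                   (allFin 5)) (allFin 5)
isOccurrence-length4 n τ π R (_ ∷ _ ∷ _ ∷ _ ∷ []) refl = refl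

boxEmpty-true : ∀ {n τ X Y x y} →
  (∀ {m} → InRange n m → X x < m → m < X (suc x) → Y y < at τ m → at τ m < Y (suc y) → ⊥) →
  boxEmpty n τ X Y x y ≡ true
boxEmpty-true {n} {τ} {X} {Y} {x} {y} empty = cong not (any-false⁺ _ (range 1 n) λ m∈ → ¬-not λ e →
  let (c₁ , e₁) = split e ; (c₂ , e₂) = split e₁ ; (c₃ , c₄) = split e₂ in
  empty (∈-range⁻ m∈) (<ᵇ-true⇒< c₁) (<ᵇ-true⇒< c₂) (<ᵇ-true⇒< c₃) (<ᵇ-true⇒< c₄))
  where
  split : ∀ {a b} → a ∧ b ≡ true → a ≡ true × b ≡ true
  split {a} {b} e = ∧-conicalˡ a b e , ∧-conicalʳ a b e

pattern2143 : List ℕ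
pattern2143 = 2 ∷ 1 ∷ 4 ∷ 3 ∷ []

orderIsomorphic-2143 : ∀ v → v 2 < v 1 → v 1 < v 4 → v 4 < v 3 → orderIsomorphic pattern2143 v ≡ true
orderIsomorphic-2143 v v₂<v₁ v₁<v₄ v₄<v₃ = decide (<-trans v₂<v₁ v₁<v₄) (<-trans v₁<v₄ v₄<v₃)
  where
  decide : v 2 < v 4 → v 1 < v 3 → orderIsomorphic pattern2143 v ≡ true
  decide v₂<v₄ v₁<v₃
    rewrite <⇒<ᵇ-true v₂<v₁ | <⇒<ᵇ-true v₁<v₄ | <⇒<ᵇ-true v₄<v₃
          | <⇒<ᵇ-true v₂<v₄ | <⇒<ᵇ-true v₁<v₃ | <⇒<ᵇ-true (<-trans v₂<v₄ v₄<v₃)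
          | ≤⇒<ᵇ-false (<⇒≤ v₂<v₁) | ≤⇒<ᵇ-false (<⇒≤ v₁<v₄) | ≤⇒<ᵇ-false (<⇒≤ v₄<v₃)
          | ≤⇒<ᵇ-false (<⇒≤ v₂<v₄) | ≤⇒<ᵇ-false (<⇒≤ v₁<v₃) | ≤⇒<ᵇ-false (<⇒≤ (<-trans v₂<v₄ v₄<v₃))
          | ≤⇒<ᵇ-false (≤-refl {v 1}) | ≤⇒<ᵇ-false (≤-refl {v 2})
          | ≤⇒<ᵇ-false (≤-refl {v 3}) | ≤⇒<ᵇ-false (≤-refl {v 4}) = refl

sort-2143 : ∀ {a b c d} → b < a → a < d → d < c → sort (a ∷ b ∷ c ∷ d ∷ []) ≡ b ∷ a ∷ d ∷ c ∷ []
sort-2143 {a} {b} {c} {d} b<a a<d d<c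
  rewrite ≤⇒<ᵇ-false {c} {suc d} d<c | <⇒<ᵇ-true {b} {suc d} (m≤n⇒m≤1+n (<-trans b<a a<d))
        | ≤⇒<ᵇ-false {a} {suc b} b<a | <⇒<ᵇ-true {a} {suc d} (m≤n⇒m≤1+n a<d) = refl

ShadedBottomOrTop : (Fin 5 → Fin 5 → Bool) → Set
ShadedBottomOrTop R = ∀ (x y : Fin 5) → R x y ≡ true → (toℕ x ≤ 3 × toℕ y ≡ 0) ⊎ toℕ y ≡ 4

module _ {n τ i j p} (π : IsPerm n τ) (1≤i : 1 ≤ i) (i<j : i < j) (j<p : j < p) (p<n : p < n)
         (max-at-p : at τ p ≡ n) (min-at-j : ∀ {m} → 1 ≤ m → m < p → m ≢ j → at τ j < at τ m)
         (i-below-next : at τ i < at τ (suc p)) where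

  private
    positions : List ℕ
    positions = i ∷ j ∷ p ∷ suc p ∷ []
    X Y : ℕ → ℕ
    X = extend n positions
    Y = extend n (sort (map (at τ) positions))
    p≤n : p ≤ n
    p≤n = <⇒≤ p<n
    j≤n : j ≤ n
    j≤n = ≤-trans (<⇒≤ j<p) p≤n
    1≤j : 1 ≤ j
    1≤j = ≤-trans 1≤i (<⇒≤ i<j)
    1≤p : 1 ≤ p
    1≤p = ≤-trans 1≤j (<⇒≤ j<p)

    B<A : at τ j < at τ i
    B<A = min-at-j 1≤i (<-trans i<j j<p) (<⇒≢ i<j)

    D<C : at τ (suc p) < at τ p
    D<C = subst (at τ (suc p) <_) (sym max-at-p) (≤∧≢⇒< (proj₂ (inRange π (s≤s z≤n , p<n))) λ eq →
      <-irrefl (injective π (1≤p , p≤n) (s≤s z≤n , p<n) (trans max-at-p (sym eq))) (n<1+n p))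

    sorted : sort (map (at τ) positions) ≡ at τ j ∷ at τ i ∷ at τ (suc p) ∷ at τ p ∷ []
    sorted = sort-2143 B<A i-below-next D<C

    top-empty : ∀ x → boxEmpty n τ X Y x 4 ≡ true
    top-empty x = boxEmpty-true {n} {τ} {X} {Y} {x} {4} λ m∈ _ _ C<τm _ →
      <⇒≱ (subst (_< _) (trans (cong (λ vs → at vs 4) sorted) max-at-p) C<τm) (proj₂ (inRange π m∈))

    next-boundary : ∀ {x} → x ≤ 3 → X (suc x) ≤ suc p
    next-boundary {0} _ = ≤-trans (<⇒≤ (<-trans i<j j<p)) (n≤1+n p)
    next-boundary {1} _ = ≤-trans (<⇒≤ j<p) (n≤1+n p)
    next-boundary {2} _ = n≤1+n p
    next-boundary {3} _ = ≤-refl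
    next-boundary {suc (suc (suc (suc _)))} (s≤s (s≤s (s≤s ())))

    bottom-empty : ∀ {x} → x ≤ 3 → boxEmpty n τ X Y x 0 ≡ true
    bottom-empty {x} x≤3 = boxEmpty-true {n} {τ} {X} {Y} {x} {0} λ {m} m∈ _ m<X _ τm<B →
      not-below-B m∈ (≤-pred (≤-trans m<X (next-boundary x≤3))) (subst (at τ m <_) (cong (λ vs → at vs 1) sorted) τm<B)
      where
      not-below-B : ∀ {m} → InRange n m → m ≤ p → ¬ (at τ m < at τ j)
      not-below-B {m} (1≤m , _) m≤p τm<B with m ≟ j | m≤n⇒m<n∨m≡n m≤p
      ... | yes refl | _ = <-irrefl refl τm<B
      ... | no m≢j | inj₁ m<p = <-asym τm<B (min-at-j 1≤m m<p m≢j)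
      ... | no _ | inj₂ refl = <⇒≱ τm<B (subst (at τ j ≤_) (sym max-at-p) (proj₂ (inRange π (1≤j , j≤n))))

  contains-2143 : ∀ {R} → ShadedBottomOrTop R → contains n τ (mesh pattern2143 R) ≡ true
  contains-2143 {R} shading = any-true⁺ _ (∈-choose-range positions increasing)
    (trans (isOccurrence-length4 n τ pattern2143 R positions refl)
      (∧-true (orderIsomorphic-2143 (at τ ∘ at positions) B<A i-below-next D<C)
              (all-true⁺ _ (allFin 5) λ {x} _ → all-true⁺ _ (allFin 5) λ {y} _ → shaded-empty x y)))
    where
    increasing : Increasing 1 n positions
    increasing = 1≤i , ≤-trans (<⇒≤ i<j) j≤n , i<j , j≤n , j<p , p≤n , ≤-refl , p<n , tt
    shaded-empty : ∀ x y → (not (R x y) ∨ boxEmpty n τ X Y (toℕ x) (toℕ y)) ≡ true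
    shaded-empty x y with R x y in shaded
    ... | false = refl
    ... | true with shading x y shaded
    ...   | inj₁ (x≤3 , y≡0) rewrite y≡0 = bottom-empty x≤3
    ...   | inj₂ y≡4 rewrite y≡4 = top-empty (toℕ x)

-- Counting permutations that avoid 2143

avoids2143 : ℕ → (Fin 5 → Fin 5 → Bool) → List ℕ → Bool
avoids2143 n R τ = not (contains n τ (mesh pattern2143 R))

edge : ℕ → ℕ → ℕ → Bool
edge c n p = (p <ᵇ suc (c * suc c)) ∨ (p == n)

earlyMinimum : ℕ → ℕ → List ℕ → Bool
earlyMinimum c p τ = any (λ r → minAt r (range 1 (pred p)) τ) (range 1 c)

nextBelowPrefix : ℕ → ℕ → List ℕ → Bool
nextBelowPrefix c p τ = minAt (suc p) (range 1 c ++ suc p ∷ []) τ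

module _ {n τ c p} (π : IsPerm n τ) (1≤c : 1 ≤ c) (c<p : c < p) (p<n : p < n) (max-at-p : at τ p ≡ n) where

  private
    c≤pred-p : c ≤ pred p
    c≤pred-p = <⇒≤pred c<p
    before-p⊆ : AllInRange n (range 1 (pred p))
    before-p⊆ s∈ with ∈-range⁻ s∈
    ... | 1≤s , s≤ = 1≤s , ≤-trans s≤ (≤-trans pred[n]≤n (<⇒≤ p<n))
    prefix⊆ : AllInRange n (range 1 c)
    prefix⊆ s∈ with ∈-range⁻ s∈
    ... | 1≤s , s≤c = 1≤s , ≤-trans s≤c (≤-trans (<⇒≤ c<p) (<⇒≤ p<n))
    next∈ : InRange n (suc p)
    next∈ = s≤s z≤n , p<n
    ≤pred-p⇒<p : ∀ {m} → m ≤ pred p → m < p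
    ≤pred-p⇒<p = m≤pred[n]⇒suc[m]≤n {{>-nonZero (≤-<-trans z≤n c<p)}}

  avoider-cases : ∀ {R} → ShadedBottomOrTop R → contains n τ (mesh pattern2143 R) ≡ false →
    earlyMinimum c p τ ≡ true ⊎ nextBelowPrefix c p τ ≡ true
  avoider-cases shading avoids with minimum-position π before-p⊆ (∈-range⁺ (≤-refl , ≤-trans 1≤c c≤pred-p))
  ... | j , j∈ , min-at-j with j ≤? c
  ...   | yes j≤c = inj₁ (any-true⁺ _ (∈-range⁺ (proj₁ (∈-range⁻ j∈) , j≤c)) min-at-j)
  ...   | no j≰c with any (λ i → at τ i <ᵇ at τ (suc p)) (range 1 c) in found
  ...     | true with any-true⁻ _ (range 1 c) found
  ...       | i , i∈ , i-below = contradiction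
    (contains-2143 π (proj₁ (∈-range⁻ i∈)) (≤-<-trans (proj₂ (∈-range⁻ i∈)) (≰⇒> j≰c)) j<p p<n max-at-p
      (λ 1≤m m<p m≢j → minAt-true⁻ {j} {range 1 (pred p)} {τ} min-at-j (∈-range⁺ (1≤m , <⇒≤pred m<p)) m≢j)
      (<ᵇ-true⇒< i-below) shading)
    (λ contains → true≢false (trans (sym contains) avoids))
    where
    j<p : j < p
    j<p = ≤pred-p⇒<p (proj₂ (∈-range⁻ j∈))
  avoider-cases shading avoids | j , j∈ , min-at-j | no j≰c | false = inj₂ (minAt-true⁺ {suc p} {range 1 c ++ suc p ∷ []} {τ} below)
    where
    below : ∀ {m} → m ∈ range 1 c ++ suc p ∷ [] → m ≢ suc p → at τ (suc p) < at τ m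
    below {m} m∈ m≢ with ∈-++⁻ (range 1 c) m∈
    ... | inj₂ (here refl) = contradiction refl m≢
    ... | inj₁ m∈prefix = ≤∧≢⇒< (<ᵇ-false⇒≤ (any-false⁻ _ found m∈prefix))
                            (λ eq → m≢ (sym (injective π next∈ (prefix⊆ m∈prefix) eq)))

#perms-nextBelowPrefix : ∀ {c n′ p} → c < p → p < suc n′ →
  suc c * #perms (suc n′) (λ τ → valueAt p (suc n′) τ ∧ nextBelowPrefix c p τ) ≡ n′ !
#perms-nextBelowPrefix {c} {n′} {p} c<p p<n = begin
  suc c * g
    ≡⟨ cong (_* g) (sym length-S) ⟩
  length S * g
    ≡⟨ sym (#perms-minAt _ S-unique S⊆ (∈-++⁺ʳ (range 1 c) (here refl)) (valueAt-SwapInvariant (suc n′) p∈ S⊆ p∉S)) ⟩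
  #perms (suc n′) (valueAt p (suc n′))
    ≡⟨ #perms-valueAt p∈ ⟩
  n′ ! ∎
  where
  open ≡-Reasoning
  S : List ℕ
  S = range 1 c ++ suc p ∷ []
  g : ℕ
  g = #perms (suc n′) (λ τ → valueAt p (suc n′) τ ∧ minAt (suc p) S τ)
  length-S : length S ≡ suc c
  length-S = trans (length-∷ʳ (range 1 c) (suc p)) (cong suc (length-range c))
  p∈ : InRange (suc n′) p
  p∈ = ≤-trans (s≤s z≤n) c<p , <⇒≤ p<n
  in-prefix : ∀ {s} → s ∈ S → InRange c s ⊎ s ≡ suc p
  in-prefix s∈ with ∈-++⁻ (range 1 c) s∈
  ... | inj₁ s∈prefix = inj₁ (∈-range⁻ s∈prefix)
  ... | inj₂ (here refl) = inj₂ refl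
  S⊆ : AllInRange (suc n′) S
  S⊆ s∈ with in-prefix s∈
  ... | inj₁ (1≤s , s≤c) = 1≤s , ≤-trans s≤c (≤-trans (<⇒≤ c<p) (<⇒≤ p<n))
  ... | inj₂ refl = s≤s z≤n , p<n
  p∉S : p ∉ S
  p∉S p∈S with in-prefix p∈S
  ... | inj₁ (_ , p≤c) = <⇒≱ c<p p≤c
  ... | inj₂ p≡ = <-irrefl p≡ (n<1+n p)
  S-unique : Unique S
  S-unique = Unique.++⁺ (range-unique c) (All.[] AllPairs.∷ AllPairs.[])
    λ { (s∈prefix , here refl) → <⇒≱ (≤-trans c<p (n≤1+n p)) (proj₂ (∈-range⁻ s∈prefix)) }

#perms-earlyMinimum : ∀ {c n′ p} → 1 ≤ c → c * suc c < p → p ≤ suc n′ →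
  suc c * #perms (suc n′) (λ τ → valueAt p (suc n′) τ ∧ earlyMinimum c p τ) ≤ n′ !
#perms-earlyMinimum {c} {n′} {p} 1≤c L<p p≤n = begin
  suc c * #perms n (λ τ → Q τ ∧ earlyMinimum c p τ)         ≤⟨ *-monoʳ-≤ (suc c) (≤-trans (#perms-mono {n} _ _ distribute) union) ⟩
  suc c * (c * e)                                           ≡⟨ sym (*-assoc (suc c) c e) ⟩
  suc c * c * e                                             ≡⟨ cong (_* e) (*-comm (suc c) c) ⟩
  c * suc c * e                                             ≤⟨ *-monoˡ-≤ e (<⇒≤pred L<p) ⟩
  pred p * e                                                ≡⟨ cong (_* e) (sym (length-range (pred p))) ⟩
  length S * e                                              ≡⟨ sym (#perms-minAt Q (range-unique (pred p)) S⊆ 1∈S Q-invariant) ⟩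
  #perms n Q                                                ≡⟨ #perms-valueAt p∈ ⟩
  n′ !                                                      ∎
  where
  open ≤-Reasoning
  n : ℕ
  n = suc n′
  S : List ℕ
  S = range 1 (pred p)
  Q : List ℕ → Bool
  Q = valueAt p n
  e : ℕ
  e = #perms n (λ τ → Q τ ∧ minAt 1 S τ)
  c≤pred-p : c ≤ pred p
  c≤pred-p = ≤-trans (m≤m*n c (suc c)) (<⇒≤pred L<p)
  p∈ : InRange n p
  p∈ = ≤-trans (s≤s z≤n) L<p , p≤n
  S⊆ : AllInRange n S
  S⊆ s∈ = proj₁ (∈-range⁻ s∈) , ≤-trans (proj₂ (∈-range⁻ s∈)) (≤-trans pred[n]≤n p≤n)
  1∈S : 1 ∈ S
  1∈S = ∈-range⁺ (≤-refl , ≤-trans 1≤c c≤pred-p)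
  Q-invariant : SwapInvariant n S Q
  Q-invariant = valueAt-SwapInvariant n p∈ S⊆ λ p∈S →
    <-irrefl refl (m≤pred[n]⇒suc[m]≤n {{>-nonZero (proj₁ p∈)}} (proj₂ (∈-range⁻ p∈S)))
  distribute : ∀ {τ} → IsPerm n τ → (Q τ ∧ earlyMinimum c p τ) ≡ true → any (λ r → Q τ ∧ minAt r S τ) (range 1 c) ≡ true
  distribute {τ} _ e′ with any-true⁻ _ (range 1 c) (∧-conicalʳ (Q τ) _ e′)
  ... | r , r∈ , min = any-true⁺ _ r∈ (∧-true (∧-conicalˡ (Q τ) _ e′) min)
  union : #perms n (λ τ → any (λ r → Q τ ∧ minAt r S τ) (range 1 c)) ≤ c * e
  union = begin
    #perms n (λ τ → any (λ r → Q τ ∧ minAt r S τ) (range 1 c)) ≤⟨ #perms-union {n = n} (λ r τ → Q τ ∧ minAt r S τ) (range 1 c) ⟩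
    sum (map (λ r → #perms n (λ τ → Q τ ∧ minAt r S τ)) (range 1 c))
      ≡⟨ sum-map-cong _ _ (range 1 c) (λ r∈ → #perms-minAt-uniform Q S⊆ 1∈S (prefix⊆S r∈) Q-invariant) ⟩
    sum (map (λ _ → e) (range 1 c))                           ≡⟨ trans (sum-map-const e (range 1 c)) (cong (_* e) (length-range c)) ⟩
    c * e                                                     ∎
    where
    prefix⊆S : ∀ {r} → r ∈ range 1 c → r ∈ S
    prefix⊆S r∈ = ∈-range⁺ (proj₁ (∈-range⁻ r∈) , ≤-trans (proj₂ (∈-range⁻ r∈)) c≤pred-p)

avoiders-with-max-at : ∀ {c n′ p R} → 1 ≤ c → ShadedBottomOrTop R → InRange (suc n′) p →
  suc c * #perms (suc n′) (λ τ → valueAt p (suc n′) τ ∧ avoids2143 (suc n′) R τ)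
    ≤ (if edge c (suc n′) p then suc c * n′ ! else 2 * n′ !)
avoiders-with-max-at {c} {n′} {p} {R} 1≤c shading p∈ with edge c (suc n′) p in at-edge
... | true = *-monoʳ-≤ (suc c) (#perms-valueAt-∧ _ p∈)
... | false with ∨-false⁻ (p <ᵇ suc (c * suc c)) at-edge
...   | not-early , not-last = begin
  suc c * #perms n (λ τ → Q τ ∧ avoids2143 n R τ)
    ≤⟨ *-monoʳ-≤ (suc c) (≤-trans (#perms-mono {n} _ _ split) (#perms-∨ {n} (λ τ → Q τ ∧ earlyMinimum c p τ) _)) ⟩
  suc c * (#early + #next)
    ≡⟨ *-distribˡ-+ (suc c) #early #next ⟩
  suc c * #early + suc c * #next
    ≤⟨ +-mono-≤ (#perms-earlyMinimum 1≤c L<p (proj₂ p∈)) (≤-reflexive (#perms-nextBelowPrefix c<p p<n)) ⟩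
  n′ ! + n′ !
    ≡⟨ cong (n′ ! +_) (sym (+-identityʳ (n′ !))) ⟩
  2 * n′ ! ∎
  where
  open ≤-Reasoning
  n : ℕ
  n = suc n′
  Q : List ℕ → Bool
  Q = valueAt p n
  #early #next : ℕ
  #early = #perms n (λ τ → Q τ ∧ earlyMinimum c p τ)
  #next = #perms n (λ τ → Q τ ∧ nextBelowPrefix c p τ)
  L<p : c * suc c < p
  L<p = <ᵇ-false⇒≤ not-early
  c<p : c < p
  c<p = ≤-<-trans (m≤m*n c (suc c)) L<p
  p<n : p < n
  p<n = ≤∧≢⇒< (proj₂ p∈) (==-false⇒≢ not-last)
  split : ∀ {τ} → IsPerm n τ → (Q τ ∧ avoids2143 n R τ) ≡ true →
    ((Q τ ∧ earlyMinimum c p τ) ∨ (Q τ ∧ nextBelowPrefix c p τ)) ≡ true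
  split {τ} π e with avoider-cases π 1≤c c<p p<n (==⇒≡ (∧-conicalˡ (Q τ) _ e)) shading
                       (not-injective (∧-conicalʳ (Q τ) _ e))
  ... | inj₁ early = ∨-trueˡ _ (∧-true (∧-conicalˡ (Q τ) _ e) early)
  ... | inj₂ next = ∨-trueʳ _ (∧-true (∧-conicalˡ (Q τ) _ e) next)

count-edge : ∀ c n → count (edge c n) (range 1 n) ≤ suc (c * suc c)
count-edge c n = begin
  count (edge c n) (range 1 n)                                       ≤⟨ count-∨ _ _ (range 1 n) ⟩
  count (λ p → p <ᵇ suc L) (range 1 n) + count (_== n) (range 1 n)   ≤⟨ +-mono-≤ early last ⟩
  L + 1                                                              ≡⟨ +-comm L 1 ⟩
  suc L                                                              ∎
  where
  open ≤-Reasoning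
  L : ℕ
  L = c * suc c
  early : count (λ p → p <ᵇ suc L) (range 1 n) ≤ L
  early = ≤-trans
    (count-≤-⊆ _ (λ _ → true) (range 1 L) (range-unique n) λ p∈ e → ∈-range⁺ (proj₁ (∈-range⁻ p∈) , ≤-pred (<ᵇ-true⇒< e)) , refl)
    (≤-reflexive (trans (count-true (range 1 L)) (length-range L)))
  last : count (_== n) (range 1 n) ≤ 1
  last = count-≤-⊆ _ (λ _ → true) (n ∷ []) (range-unique n) λ _ e → subst (_∈ n ∷ []) (sym (==⇒≡ e)) (here refl) , refl

avoiders-bound : ∀ {c n′ R} → 1 ≤ c → ShadedBottomOrTop R →
  suc c * #perms (suc n′) (avoids2143 (suc n′) R) ≤ suc (c * suc c) * (suc c * n′ !) + suc n′ * (2 * n′ !)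
avoiders-bound {c} {n′} {R} 1≤c shading = begin
  suc c * #perms n (avoids2143 n R)
    ≡⟨ cong (suc c *_) (#perms-by-maximum n′ (avoids2143 n R)) ⟩
  suc c * sum (map (λ p → #perms n (λ τ → valueAt p n τ ∧ avoids2143 n R τ)) (range 1 n))
    ≡⟨ *-distribˡ-sum-map (suc c) _ (range 1 n) ⟩
  sum (map (λ p → suc c * #perms n (λ τ → valueAt p n τ ∧ avoids2143 n R τ)) (range 1 n))
    ≤⟨ sum-map-mono _ _ (range 1 n) (λ p∈ → avoiders-with-max-at 1≤c shading (∈-range⁻ p∈)) ⟩
  sum (map (λ p → if edge c n p then suc c * n′ ! else 2 * n′ !) (range 1 n))
    ≤⟨ sum-map-if (edge c n) _ _ (range 1 n) ⟩
  count (edge c n) (range 1 n) * (suc c * n′ !) + length (range 1 n) * (2 * n′ !)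
    ≤⟨ +-mono-≤ (*-monoˡ-≤ _ (count-edge c n)) (≤-reflexive (cong (_* (2 * n′ !)) (length-range n))) ⟩
  suc (c * suc c) * (suc c * n′ !) + n * (2 * n′ !) ∎
  where
  open ≤-Reasoning
  n : ℕ
  n = suc n′

avoiders-estimate : ∀ {k M L n X F} → M ≡ 4 * suc k → suc L * M ≤ n →
  M * F ≤ suc L * (M * X) + n * (2 * X) → 0 < n * X → suc k * F < n * X
avoiders-estimate {k} {M} {L} {n} {X} {F} refl n-large bound 0<nX = *-cancelˡ-< 4 (suc k * F) (n * X) (begin-strict
  4 * (suc k * F)                 ≡⟨ sym (*-assoc 4 (suc k) F) ⟩
  M * F                           ≤⟨ bound ⟩
  suc L * (M * X) + n * (2 * X)   ≡⟨ cong₂ _+_ (sym (*-assoc (suc L) M X)) (two-outside) ⟩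
  suc L * M * X + 2 * (n * X)     ≤⟨ +-monoˡ-≤ (2 * (n * X)) (*-monoˡ-≤ X n-large) ⟩
  3 * (n * X)                     <⟨ *-monoˡ-< (n * X) {{>-nonZero 0<nX}} (n<1+n 3) ⟩
  4 * (n * X)                     ∎)
  where
  open ≤-Reasoning
  two-outside : n * (2 * X) ≡ 2 * (n * X)
  two-outside = trans (sym (*-assoc n 2 X)) (trans (cong (_* X) (*-comm n 2)) (*-assoc 2 n X))

corollary4p10 : (R : Fin 5 → Fin 5 → Bool)
    → (∀ (x y : Fin 5) → R x y ≡ true → (toℕ x ≤ 3 × toℕ y ≡ 0) ⊎ toℕ y ≡ 4)
    → RatioTendsToOne (λ n → s⁺ n (mesh (2 ∷ 1 ∷ 4 ∷ 3 ∷ []) R)) (λ n → n !)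
corollary4p10 R shading k = N , close
  where
  c N : ℕ
  -- so that c + 1 = 4 (k + 1)
  c = 3 + 4 * k
  N = suc (c * suc c) * suc c
  close : ∀ n → N ≤ n → suc k * ∣ s⁺ n (mesh pattern2143 R) - n ! ∣ < n !
  close zero ()
  close (suc n′) N≤n = begin-strict
    suc k * ∣ s⁺ (suc n′) (mesh pattern2143 R) - suc n′ ! ∣
      ≡⟨ cong (suc k *_) (∣s⁺-n!∣≡#avoiders (suc n′) (mesh pattern2143 R)) ⟩
    suc k * #perms (suc n′) (avoids2143 (suc n′) R)
      <⟨ avoiders-estimate {L = c * suc c} (sym (*-suc 4 k)) N≤n (avoiders-bound {c} {n′} (s≤s z≤n) shading) (1≤n! (suc n′)) ⟩
    suc n′ ! ∎
    where open ≤-Reasoning
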